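{- Let $P=\{x_1,\dots,x_d\}$ be a finite poset, let $c_1,\dots,c_d\in\mathbb{R}$ be not all zero, let $h(x)=c_1x_1+\cdots+c_dx_d$, and let $\mathcal{H}$ be the hyperplane $h(x)=0$. Then $\mathcal{H}$ is a separating hyperplane of the order polytope $\mathcal{O}(P)$ if and only if both of the following hold: (1) there exist poset ideals $I,J$ of $P$ with $h(\rho(I))>0$ and $h(\rho(J))<0$; (2) $h(\rho(I))\,h(\rho(J))\ge 0$ for every pair of poset ideals $I,J$ of $P$ such that $(I\setminus J)\cup(J\setminus I)$ is connected in $P$.
   Context: For $W\subset P$, $\rho(W)=\sum_{x_i\in W}\mathbf{e}_i\in\mathbb{R}^d$ with $\mathbf{e}_i$ the unit coordinate vectors. A poset ideal of $P$ is a subset $I$ such that $x_i\in I$ and $x_j\le x_i$ imply $x_j\in I$. The order polytope $\mathcal{O}(P)\subset\mathbb{R}^d$ is the set of $(a_1,\dots,a_d)$ with $0\le a_i\le 1$ for all $i$ and $a_i\ge a_j$ whenever $x_i\le x_j$ in $P$; its vertices are the $\rho(I)$, $I$ a poset ideal. A subset $W\subset P$ is connected in $P$ if the induced subposet on $W$ is connected (its comparability graph is connected). For a convex polytope $\mathcal{P}$ and a hyperplane $\mathcal{H}$ with closed half-spaces $\mathcal{H}^{(+)},\mathcal{H}^{(-)}$ ($\mathcal{H}^{(+)}\cap\mathcal{H}^{(-)}=\mathcal{H}$), $\mathcal{H}$ is a separating hyperplane of $\mathcal{P}$ if $\mathcal{H}$ meets the (relative) interior of $\mathcal{P}$ and every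 vertex of each of $\mathcal{P}\cap\mathcal{H}^{(+)}$ and $\mathcal{P}\cap\mathcal{H}^{(-)}$ is a vertex of $\mathcal{P}$. -}

module Defs where

open import Level using (0ℓ)
open import Data.Nat using (ℕ; zero; suc)
open import Data.Fin using (Fin; zero; suc)
open import Data.Fin.Subset using (Subset; _∈_; _∪_; _─_)
open import Data.Vec using (lookup)
open import Data.Bool using (if_then_else_)
open import Data.Product using (Σ; ∃; _×_; _,_)
open import Data.Sum using (_⊎_)
open import Relation.Nullary using (¬_)
open import Relation.Binary.Core using (Rel)
open import Relation.Binary.Structures using (IsStrictTotalOrder; IsPartialOrder)
open import Relation.Binary.PropositionalEquality using (_≡_)
open import Algebra.Structures using (IsCommutativeRing)

-- The real numbers, axiomatised as a complete ordered field.
-- (agda-stdlib has no reals; every complete ordered field is isomorphic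
-- to ℝ, so quantifying over all such records is quantifying over ℝ.)

record RealField : Set₁ where
  infixl 6 _+_
  infixl 7 _*_
  infix 4 _<_ _≤_
  field
    Carrier : Set
    0# 1#   : Carrier
    _+_ _*_ : Carrier → Carrier → Carrier
    -_      : Carrier → Carrier
    _<_     : Rel Carrier 0ℓ
    isCommutativeRing  : IsCommutativeRing _≡_ _+_ _*_ -_ 0# 1#
    0≢1                : ¬ (0# ≡ 1#)
    inverse            : ∀ x → ¬ (x ≡ 0#) → ∃ λ y → x * y ≡ 1#
    isStrictTotalOrder : IsStrictTotalOrder _≡_ _<_
    +-mono-<           : ∀ {x y} z → x < y → x + z < y + z
    *-pos              : ∀ {x y} → 0# < x → 0# < y → 0# < x * y

  _≤_ : Rel Carrier 0ℓ
  x ≤ y = (x < y) ⊎ (x ≡ y)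

  field
    completeness : (S : Carrier → Set) → Σ Carrier S →
                   (Σ Carrier λ b → ∀ x → S x → x ≤ b) →
                   Σ Carrier λ s → (∀ x → S x → x ≤ s) ×
                                   (∀ b → (∀ x → S x → x ≤ b) → s ≤ b)

module Geometry (R : RealField) where
  open RealField R public

  _-_ : Carrier → Carrier → Carrier
  x - y = x + (- y)

  Point : ℕ → Set
  Point d = Fin d → Carrier

  sumFin : ∀ {d} → (Fin d → Carrier) → Carrier
  sumFin {zero}  f = 0#
  sumFin {suc d} f = f zero + sumFin (λ i → f (suc i))

  lin : ∀ {d} → Point d → Point d → Carrier
  lin c x = sumFin (λ i → c i * x i)

  ρ : ∀ {d} → Subset d → Point d
  ρ W i = if lookup W i then 1# else 0#

  IsVertex : ∀ {d} → (Point d → Set) → Point d → Set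
  IsVertex S x = S x × (∀ y z t → S y → S z → 0# < t → t < 1# →
                        (∀ i → x i ≡ t * y i + (1# - t) * z i) →
                        ∀ i → y i ≡ z i)

  InRelInt : ∀ {d} → (Point d → Set) → Point d → Set
  InRelInt S x = S x × (∀ y → S y → Σ Carrier λ ε → (0# < ε) ×
                          S (λ i → x i + ε * (x i - y i)))

  IsSeparatingHyperplane : ∀ {d} → (Point d → Set) → Point d → Set
  IsSeparatingHyperplane S c =
    (Σ _ λ x → (lin c x ≡ 0#) × InRelInt S x) ×
    (∀ x → IsVertex (λ y → S y × (0# ≤ lin c y)) x → IsVertex S x) ×
    (∀ x → IsVertex (λ y → S y × (lin c y ≤ 0#)) x → IsVertex S x)

  module PosetStuff {d : ℕ} (_≼_ : Rel (Fin d) 0ℓ) where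

    OrderPolytope : Point d → Set
    OrderPolytope a = (∀ i → (0# ≤ a i) × (a i ≤ 1#)) ×
                      (∀ i j → i ≼ j → a j ≤ a i)

    IsIdeal : Subset d → Set
    IsIdeal I = ∀ i j → i ∈ I → j ≼ i → j ∈ I

    data Path (W : Subset d) (i : Fin d) : Fin d → Set where
      here : Path W i i
      step : ∀ {j k} → Path W i j → k ∈ W → (j ≼ k ⊎ k ≼ j) → Path W i k

    Connected : Subset d → Set
    Connected W = ∀ i j → i ∈ W → j ∈ W → Path W i j

    symDiff : Subset d → Subset d → Subset d
    symDiff I J = (I ─ J) ∪ (J ─ I)

{-# OPTIONS --safe #-}
-- (⇒) If h were ≤ 0 on all ideal vectors, it would be ≤ 0 on the cone they span,
-- which contains O(P); a root of h in the relative interior then forces h = 0 on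
-- O(P), and c i = h(ρ ↓i) − h(ρ (↓i ∖ {i})) = 0.  Ideals with a connected
-- symmetric difference are nested, say I ⊆ J; if h(ρ I) < 0 < h(ρ J), the root x
-- of h on the segment [ρ I, ρ J] is a vertex of O ∩ H⁺, because any decomposition
-- of x there is 1 on I, 0 off J and constant on the connected J ∖ I, but x is not
-- a vertex of O.
-- (⇐) Walking from a point with uniform slack towards an ideal vector of opposite
-- sign gives a root of h in the relative interior.  A vertex x of O ∩ H⁺ with a
-- fractional coordinate is impossible: two components of fractional level sets
-- give a direction along H that keeps x inside O ∩ H⁺ both ways, and a single one
-- writes x as a proper convex combination of ρ B and ρ A for the ideals A = {x = 1}
-- and B = {x > 0}, which the sign condition puts into H⁺.
-- Since ≼ need not be decidable, comparabilities and paths are decided up to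
-- double negation by weak excluded middle, which completeness of the field gives.
module Submission where

open import Defs
open import Level using (0ℓ)
open import Data.Nat using (ℕ)
open import Data.Fin using (Fin)
open import Data.Fin.Subset using (Subset)
open import Data.Product using (Σ; _×_; _,_)
open import Relation.Nullary using (¬_)
open import Relation.Binary.Core using (Rel)
open import Relation.Binary.Structures using (IsPartialOrder)
open import Relation.Binary.PropositionalEquality using (_≡_)
open import Function.Bundles using (_⇔_; mk⇔)

import Data.Nat as ℕ
import Data.Nat.Properties as ℕ
import Data.Fin as Fin
import Data.Fin.Properties as Fin
import Data.Sum
open import Algebra.Bundles using (CommutativeRing; RawRing)
open import Algebra.Solver.Ring.AlmostCommutativeRing
  using (_-Raw-AlmostCommutative⟶_; fromCommutativeRing)
open import Data.Bool using (true; false)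
open import Data.Empty using (⊥; ⊥-elim)
open import Data.Fin.Subset using (_∈_; _∉_; _⊆_; _⊂_; _─_; ∣_∣; outside)
open import Data.Fin.Subset.Properties
  using (_∈?_; x∈p∪q⁻; x∈p∪q⁺; p─q⊆p; x∈p∧x∉q⇒x∈p─q; ∣p∣≤n; p⊂q⇒∣p∣<∣q∣; anySubset?; ∣⊤∣≡n; ∈⊤)
open import Data.Maybe using (Maybe; just; nothing)
open import Data.Product using (∃; proj₁; proj₂; uncurry)
open import Data.Sum using (_⊎_; inj₁; inj₂)
open import Data.Vec using (_∷_; lookup; tabulate)
open import Data.Vec.Base using (here; there)
open import Data.Vec.Properties using ([]=⇒lookup; lookup⇒[]=; lookup∘tabulate)
open import Function using (_∘_)
open import Relation.Binary.Definitions using (tri<; tri≈; tri>)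
open import Relation.Binary.PropositionalEquality
  using (refl; sym; trans; cong; cong₂; subst; subst₂; module ≡-Reasoning)
open import Relation.Binary.Structures using (IsStrictTotalOrder; IsDecTotalOrder)
import Relation.Binary.Construct.StrictToNonStrict as NonStrict
open import Relation.Nullary using (Dec; yes; no; does)
open import Relation.Nullary.Decidable using (decidable-stable; dec-true; ¬?; _×-dec_; _→-dec_)
open import Relation.Nullary.Negation using (¬¬-map)
open import Relation.Unary using (Pred; Decidable)

module OrderedField (R : RealField) where
  open Geometry R public hiding (_-_)

  -- The same subtraction as in Geometry, but with a fixity declaration.
  infixl 6 _-_
  _-_ : Carrier → Carrier → Carrier
  x - y = x + - y

  commutativeRing : CommutativeRing 0ℓ 0ℓ
  commutativeRing = record { isCommutativeRing = isCommutativeRing }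

  open CommutativeRing commutativeRing public
    using ( +-comm; +-assoc; *-comm; *-assoc; zeroˡ; zeroʳ
          ; +-identityˡ; +-identityʳ; *-identityˡ; *-identityʳ; -‿inverseʳ
          ; ring; semiring; +-commutativeSemigroup; +-abelianGroup )
  open import Algebra.Properties.Ring ring public
    using (-‿involutive; -0#≈0#; -‿distribˡ-*; -‿distribʳ-*; x[y-z]≈xy-xz; [y-z]x≈yx-zx)
  open import Algebra.Properties.AbelianGroup +-abelianGroup
    using (⁻¹-∙-comm; ⁻¹-anti-homo‿-)
  open import Algebra.Properties.CommutativeSemigroup +-commutativeSemigroup
    using (interchange)
  open import Algebra.Properties.Semiring.Mult.TCOptimised semiring
    using (×-homo-+; ×1-homo-*) renaming (_×_ to _times_)

  fromℕ : ℕ → Carrier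
  fromℕ n = n times 1#

  fromℕ-+ : ∀ m n → fromℕ (m ℕ.+ n) ≡ fromℕ m + fromℕ n
  fromℕ-+ m n = ×-homo-+ 1# m n

  fromℕ-* : ∀ m n → fromℕ (m ℕ.* n) ≡ fromℕ m * fromℕ n
  fromℕ-* = ×1-homo-*

  [x+y]-[u+v]≡[x-u]+[y-v] : ∀ x y u v → (x + y) - (u + v) ≡ (x - u) + (y - v)
  [x+y]-[u+v]≡[x-u]+[y-v] x y u v =
    trans (cong ((x + y) +_) (sym (⁻¹-∙-comm u v))) (interchange x y (- u) (- v))

  [x+z]-[y+z]≡x-y : ∀ x y z → (x + z) - (y + z) ≡ x - y
  [x+z]-[y+z]≡x-y x y z = begin
    (x + z) - (y + z)    ≡⟨ [x+y]-[u+v]≡[x-u]+[y-v] x z y z ⟩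
    (x - y) + (z - z)    ≡⟨ cong ((x - y) +_) (-‿inverseʳ z) ⟩
    (x - y) + 0#         ≡⟨ +-identityʳ (x - y) ⟩
    x - y                ∎
    where open ≡-Reasoning

  -- The ring solver with integer coefficients, represented as pairs (a , b)
  -- meaning a − b; keeping one component zero makes coefficient arithmetic
  -- compute, which is what lets the solver close goals by refl.
  private
    Coefficient : Set
    Coefficient = ℕ × ℕ

    canonical : ℕ → ℕ → Coefficient
    canonical a b = a ℕ.∸ b , b ℕ.∸ a

    _+ᶜ_ _*ᶜ_ : Coefficient → Coefficient → Coefficient
    (a , b) +ᶜ (c , e) = canonical (a ℕ.+ c) (b ℕ.+ e)
    (a , b) *ᶜ (c , e) = canonical (a ℕ.* c ℕ.+ b ℕ.* e) (a ℕ.* e ℕ.+ b ℕ.* c)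

    coefficients : RawRing 0ℓ 0ℓ
    coefficients = record
      { Carrier = Coefficient ; _≈_ = _≡_ ; _+_ = _+ᶜ_ ; _*_ = _*ᶜ_
      ; -_ = λ (a , b) → b , a ; 0# = 0 , 0 ; 1# = 1 , 0 }

    -- Constants must evaluate to 0# and 1# on the nose, hence the special case.
    ⟦_⟧ᶜ : Coefficient → Carrier
    ⟦ a , 0 ⟧ᶜ = fromℕ a
    ⟦ a , b ⟧ᶜ = fromℕ a - fromℕ b

    ⟦_⟧ᵈ : Coefficient → Carrier
    ⟦ a , b ⟧ᵈ = fromℕ a - fromℕ b

    ⟦⟧ᶜ≡⟦⟧ᵈ : ∀ p → ⟦ p ⟧ᶜ ≡ ⟦ p ⟧ᵈ
    ⟦⟧ᶜ≡⟦⟧ᵈ (a , 0) = sym (trans (cong (fromℕ a +_) -0#≈0#) (+-identityʳ (fromℕ a)))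
    ⟦⟧ᶜ≡⟦⟧ᵈ (a , ℕ.suc b) = refl

    ⟦canonical⟧ : ∀ a b → ⟦ canonical a b ⟧ᵈ ≡ fromℕ a - fromℕ b
    ⟦canonical⟧ a b with ℕ.≤-total a b
    ... | inj₁ a≤b = begin
      fromℕ (a ℕ.∸ b) - fromℕ (b ℕ.∸ a)
        ≡⟨ cong (λ n → fromℕ n - fromℕ (b ℕ.∸ a)) (ℕ.m≤n⇒m∸n≡0 a≤b) ⟩
      0# - fromℕ (b ℕ.∸ a)                      ≡⟨ [x+z]-[y+z]≡x-y 0# _ (fromℕ a) ⟨
      (0# + fromℕ a) - (fromℕ (b ℕ.∸ a) + fromℕ a)
        ≡⟨ cong₂ _-_ (+-identityˡ (fromℕ a)) (sym (fromℕ-+ (b ℕ.∸ a) a)) ⟩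
      fromℕ a - fromℕ (b ℕ.∸ a ℕ.+ a)           ≡⟨ cong (λ n → fromℕ a - fromℕ n) (ℕ.m∸n+n≡m a≤b) ⟩
      fromℕ a - fromℕ b                         ∎
      where open ≡-Reasoning
    ... | inj₂ b≤a = begin
      fromℕ (a ℕ.∸ b) - fromℕ (b ℕ.∸ a)
        ≡⟨ cong (λ n → fromℕ (a ℕ.∸ b) - fromℕ n) (ℕ.m≤n⇒m∸n≡0 b≤a) ⟩
      fromℕ (a ℕ.∸ b) - 0#                      ≡⟨ [x+z]-[y+z]≡x-y _ 0# (fromℕ b) ⟨
      (fromℕ (a ℕ.∸ b) + fromℕ b) - (0# + fromℕ b)
        ≡⟨ cong₂ _-_ (sym (fromℕ-+ (a ℕ.∸ b) b)) (+-identityˡ (fromℕ b)) ⟩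
      fromℕ (a ℕ.∸ b ℕ.+ b) - fromℕ b           ≡⟨ cong (λ n → fromℕ n - fromℕ b) (ℕ.m∸n+n≡m b≤a) ⟩
      fromℕ a - fromℕ b                         ∎
      where open ≡-Reasoning

    +ᵈ-homo : ∀ p q → ⟦ p +ᶜ q ⟧ᵈ ≡ ⟦ p ⟧ᵈ + ⟦ q ⟧ᵈ
    +ᵈ-homo (a , b) (c , e) = begin
      ⟦ canonical (a ℕ.+ c) (b ℕ.+ e) ⟧ᵈ         ≡⟨ ⟦canonical⟧ (a ℕ.+ c) (b ℕ.+ e) ⟩
      fromℕ (a ℕ.+ c) - fromℕ (b ℕ.+ e)          ≡⟨ cong₂ _-_ (fromℕ-+ a c) (fromℕ-+ b e) ⟩
      (fromℕ a + fromℕ c) - (fromℕ b + fromℕ e)  ≡⟨ [x+y]-[u+v]≡[x-u]+[y-v] _ _ _ _ ⟩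
      ⟦ a , b ⟧ᵈ + ⟦ c , e ⟧ᵈ                    ∎
      where open ≡-Reasoning

    *ᵈ-homo : ∀ p q → ⟦ p *ᶜ q ⟧ᵈ ≡ ⟦ p ⟧ᵈ * ⟦ q ⟧ᵈ
    *ᵈ-homo (a , b) (c , e) = begin
      ⟦ canonical (a ℕ.* c ℕ.+ b ℕ.* e) (a ℕ.* e ℕ.+ b ℕ.* c) ⟧ᵈ
        ≡⟨ ⟦canonical⟧ (a ℕ.* c ℕ.+ b ℕ.* e) (a ℕ.* e ℕ.+ b ℕ.* c) ⟩
      fromℕ (a ℕ.* c ℕ.+ b ℕ.* e) - fromℕ (a ℕ.* e ℕ.+ b ℕ.* c)
        ≡⟨ cong₂ _-_ (trans (fromℕ-+ (a ℕ.* c) (b ℕ.* e)) (cong₂ _+_ (fromℕ-* a c) (fromℕ-* b e)))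
                     (trans (fromℕ-+ (a ℕ.* e) (b ℕ.* c)) (cong₂ _+_ (fromℕ-* a e) (fromℕ-* b c))) ⟩
      (A * C + B * E) - (A * E + B * C)   ≡⟨ [x+y]-[u+v]≡[x-u]+[y-v] _ _ _ _ ⟩
      (A * C - A * E) + (B * E - B * C)   ≡⟨ cong₂ _+_ (sym (x[y-z]≈xy-xz A C E)) (sym (x[y-z]≈xy-xz B E C)) ⟩
      A * (C - E) + B * (E - C)           ≡⟨ cong (λ t → A * (C - E) + B * t) (sym (⁻¹-anti-homo‿- C E)) ⟩
      A * (C - E) + B * - (C - E)         ≡⟨ cong (A * (C - E) +_) (sym (-‿distribʳ-* B (C - E))) ⟩
      A * (C - E) - B * (C - E)           ≡⟨ sym ([y-z]x≈yx-zx (C - E) A B) ⟩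
      (A - B) * (C - E)                   ∎
      where
        open ≡-Reasoning
        A B C E : Carrier
        A = fromℕ a
        B = fromℕ b
        C = fromℕ c
        E = fromℕ e

    homomorphism : coefficients -Raw-AlmostCommutative⟶ fromCommutativeRing commutativeRing
    homomorphism = record
      { ⟦_⟧ = ⟦_⟧ᶜ
      ; +-homo = λ p q → via⟦⟧ᵈ (p +ᶜ q) (+ᵈ-homo p q) (cong₂ _+_ (⟦⟧ᶜ≡⟦⟧ᵈ p) (⟦⟧ᶜ≡⟦⟧ᵈ q))
      ; *-homo = λ p q → via⟦⟧ᵈ (p *ᶜ q) (*ᵈ-homo p q) (cong₂ _*_ (⟦⟧ᶜ≡⟦⟧ᵈ p) (⟦⟧ᶜ≡⟦⟧ᵈ q))
      ; -‿homo = λ (a , b) →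
          via⟦⟧ᵈ (b , a) (sym (⁻¹-anti-homo‿- (fromℕ a) (fromℕ b))) (cong -_ (⟦⟧ᶜ≡⟦⟧ᵈ (a , b)))
      ; 0-homo = refl
      ; 1-homo = refl
      }
      where
        via⟦⟧ᵈ : ∀ p {x y} → ⟦ p ⟧ᵈ ≡ x → y ≡ x → ⟦ p ⟧ᶜ ≡ y
        via⟦⟧ᵈ p p≡x y≡x = trans (⟦⟧ᶜ≡⟦⟧ᵈ p) (trans p≡x (sym y≡x))

    _≟ᶜ_ : ∀ p q → Maybe (⟦ p ⟧ᶜ ≡ ⟦ q ⟧ᶜ)
    (a , b) ≟ᶜ (c , e) with a ℕ.≟ c | b ℕ.≟ e
    ... | yes refl | yes refl = just refl
    ... | _        | _        = nothing

  open import Algebra.Solver.Ring coefficients (fromCommutativeRing commutativeRing) homomorphism _≟ᶜ_ public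
    using (Polynomial; solve; _:=_; _:+_; _:*_; :-_; _:-_; con)

  :0 :1 : ∀ {n} → Polynomial n
  :0 = con (0 , 0)
  :1 = con (1 , 0)

  open IsStrictTotalOrder isStrictTotalOrder public
    using (compare; _≟_; _<?_) renaming (trans to <-trans; asym to <-asym)
  open IsStrictTotalOrder isStrictTotalOrder using (<-respˡ-≈; <-respʳ-≈)
  open IsDecTotalOrder (NonStrict.isDecTotalOrder _≡_ _<_ isStrictTotalOrder) public
    using (_≤?_) renaming (refl to ≤-refl; trans to ≤-trans; antisym to ≤-antisym)

  <-irrefl : ∀ {x} → ¬ x < x
  <-irrefl = IsStrictTotalOrder.irrefl isStrictTotalOrder refl

  <⇒≢ : ∀ {x y} → x < y → ¬ x ≡ y
  <⇒≢ x<y refl = <-irrefl x<y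

  <-≤-trans : ∀ {x y z} → x < y → y ≤ z → x < z
  <-≤-trans = NonStrict.<-≤-trans _≡_ _<_ <-trans <-respʳ-≈

  ≤-<-trans : ∀ {x y z} → x ≤ y → y < z → x < z
  ≤-<-trans = NonStrict.≤-<-trans _≡_ _<_ sym <-trans <-respˡ-≈

  <⇒≱ : ∀ {x y} → x < y → ¬ y ≤ x
  <⇒≱ x<y y≤x = <-irrefl (<-≤-trans x<y y≤x)

  ≮⇒≥ : ∀ {x y} → ¬ x < y → y ≤ x
  ≮⇒≥ {x} {y} x≮y with compare x y
  ... | tri< x<y _ _ = ⊥-elim (x≮y x<y)
  ... | tri≈ _ x≡y _ = inj₂ (sym x≡y)
  ... | tri> _ _ y<x = inj₁ y<x

  ≰⇒> : ∀ {x y} → ¬ x ≤ y → y < x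
  ≰⇒> {x} {y} x≰y with compare x y
  ... | tri< x<y _ _ = ⊥-elim (x≰y (inj₁ x<y))
  ... | tri≈ _ x≡y _ = ⊥-elim (x≰y (inj₂ x≡y))
  ... | tri> _ _ y<x = y<x

  ≤∧≢⇒< : ∀ {x y} → x ≤ y → ¬ x ≡ y → x < y
  ≤∧≢⇒< (inj₁ x<y) _   = x<y
  ≤∧≢⇒< (inj₂ x≡y) x≢y = ⊥-elim (x≢y x≡y)

  +-monoʳ-< : ∀ {x y} z → x < y → z + x < z + y
  +-monoʳ-< z x<y = subst₂ _<_ (+-comm _ z) (+-comm _ z) (+-mono-< z x<y)

  +-monoˡ-≤ : ∀ {x y} z → x ≤ y → x + z ≤ y + z
  +-monoˡ-≤ z (inj₁ x<y)  = inj₁ (+-mono-< z x<y)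
  +-monoˡ-≤ z (inj₂ refl) = ≤-refl

  +-monoʳ-≤ : ∀ {x y} z → x ≤ y → z + x ≤ z + y
  +-monoʳ-≤ z (inj₁ x<y)  = inj₁ (+-monoʳ-< z x<y)
  +-monoʳ-≤ z (inj₂ refl) = ≤-refl

  +-mono-≤ : ∀ {x y u v} → x ≤ y → u ≤ v → x + u ≤ y + v
  +-mono-≤ {y = y} {u} x≤y u≤v = ≤-trans (+-monoˡ-≤ u x≤y) (+-monoʳ-≤ y u≤v)

  +-mono-<-≤ : ∀ {x y u v} → x < y → u ≤ v → x + u < y + v
  +-mono-<-≤ {y = y} {u} x<y u≤v = <-≤-trans (+-mono-< u x<y) (+-monoʳ-≤ y u≤v)

  +-mono-≤-< : ∀ {x y u v} → x ≤ y → u < v → x + u < y + v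
  +-mono-≤-< {y = y} {u} x≤y u<v = ≤-<-trans (+-monoˡ-≤ u x≤y) (+-monoʳ-< y u<v)

  x<y⇒0<y-x : ∀ {x y} → x < y → 0# < y - x
  x<y⇒0<y-x {x} x<y = subst (_< _) (-‿inverseʳ x) (+-mono-< (- x) x<y)

  0<y-x⇒x<y : ∀ {x y} → 0# < y - x → x < y
  0<y-x⇒x<y {x} {y} 0<y-x =
    subst₂ _<_ (+-identityˡ x) (solve 2 (λ x y → y :- x :+ x := y) refl x y) (+-mono-< x 0<y-x)

  x≤y⇒0≤y-x : ∀ {x y} → x ≤ y → 0# ≤ y - x
  x≤y⇒0≤y-x (inj₁ x<y)      = inj₁ (x<y⇒0<y-x x<y)
  x≤y⇒0≤y-x {x} (inj₂ refl) = inj₂ (sym (-‿inverseʳ x))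

  0≤y-x⇒x≤y : ∀ {x y} → 0# ≤ y - x → x ≤ y
  0≤y-x⇒x≤y (inj₁ 0<y-x) = inj₁ (0<y-x⇒x<y 0<y-x)
  0≤y-x⇒x≤y {x} {y} (inj₂ 0≡y-x) =
    inj₂ (trans (sym (+-identityˡ x)) (trans (cong (_+ x) 0≡y-x) (solve 2 (λ x y → y :- x :+ x := y) refl x y)))

  x-y≡0⇒x≡y : ∀ {x y} → x - y ≡ 0# → x ≡ y
  x-y≡0⇒x≡y {x} {y} x-y≡0 =
    trans (solve 2 (λ x y → x := x :- y :+ y) refl x y) (trans (cong (_+ y) x-y≡0) (+-identityˡ y))

  neg-antimono-< : ∀ {x y} → x < y → - y < - x
  neg-antimono-< {x} {y} x<y =
    0<y-x⇒x<y (subst (0# <_) (solve 2 (λ x y → y :- x := (:- x) :- (:- y)) refl x y) (x<y⇒0<y-x x<y))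

  neg-antimono-≤ : ∀ {x y} → x ≤ y → - y ≤ - x
  neg-antimono-≤ (inj₁ x<y)  = inj₁ (neg-antimono-< x<y)
  neg-antimono-≤ (inj₂ refl) = ≤-refl

  x<0⇒0<-x : ∀ {x} → x < 0# → 0# < - x
  x<0⇒0<-x x<0 = subst (_< _) -0#≈0# (neg-antimono-< x<0)

  0<x⇒-x<0 : ∀ {x} → 0# < x → - x < 0#
  0<x⇒-x<0 0<x = subst (_ <_) -0#≈0# (neg-antimono-< 0<x)

  x≤0⇒0≤-x : ∀ {x} → x ≤ 0# → 0# ≤ - x
  x≤0⇒0≤-x x≤0 = subst (_≤ _) -0#≈0# (neg-antimono-≤ x≤0)

  0≤-x⇒x≤0 : ∀ {x} → 0# ≤ - x → x ≤ 0#
  0≤-x⇒x≤0 {x} 0≤-x = subst₂ _≤_ (-‿involutive x) -0#≈0# (neg-antimono-≤ 0≤-x)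

  0<-x⇒x<0 : ∀ {x} → 0# < - x → x < 0#
  0<-x⇒x<0 {x} 0<-x = subst₂ _<_ (-‿involutive x) -0#≈0# (neg-antimono-< 0<-x)

  -x≤0⇒0≤x : ∀ {x} → - x ≤ 0# → 0# ≤ x
  -x≤0⇒0≤x {x} -x≤0 = subst (0# ≤_) (-‿involutive x) (x≤0⇒0≤-x -x≤0)

  0<1 : 0# < 1#
  0<1 with compare 0# 1#
  ... | tri< 0<1 _ _ = 0<1
  ... | tri≈ _ 0≡1 _ = ⊥-elim (0≢1 0≡1)
  ... | tri> _ _ 1<0 = ⊥-elim (<-asym 1<0 (subst (0# <_) (solve 0 ((:- :1) :* (:- :1) := :1) refl)
                                             (*-pos (x<0⇒0<-x 1<0) (x<0⇒0<-x 1<0))))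

  0≤1 : 0# ≤ 1#
  0≤1 = inj₁ 0<1

  +-nonNeg : ∀ {x y} → 0# ≤ x → 0# ≤ y → 0# ≤ x + y
  +-nonNeg 0≤x 0≤y = subst (_≤ _) (+-identityʳ 0#) (+-mono-≤ 0≤x 0≤y)

  +-pos-nonNeg : ∀ {x y} → 0# < x → 0# ≤ y → 0# < x + y
  +-pos-nonNeg 0<x 0≤y = subst (_< _) (+-identityʳ 0#) (+-mono-<-≤ 0<x 0≤y)

  *-nonNeg : ∀ {x y} → 0# ≤ x → 0# ≤ y → 0# ≤ x * y
  *-nonNeg (inj₁ 0<x)      (inj₁ 0<y)  = inj₁ (*-pos 0<x 0<y)
  *-nonNeg {x} _           (inj₂ refl) = inj₂ (sym (zeroʳ x))
  *-nonNeg {y = y} (inj₂ refl) (inj₁ _) = inj₂ (sym (zeroˡ y))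

  *-monoˡ-<-pos : ∀ {z x y} → 0# < z → x < y → z * x < z * y
  *-monoˡ-<-pos {z} {x} {y} 0<z x<y = 0<y-x⇒x<y (subst (0# <_)
    (solve 3 (λ z x y → z :* (y :- x) := z :* y :- z :* x) refl z x y) (*-pos 0<z (x<y⇒0<y-x x<y)))

  *-monoˡ-≤-nonNeg : ∀ {z x y} → 0# ≤ z → x ≤ y → z * x ≤ z * y
  *-monoˡ-≤-nonNeg {z} {x} {y} 0≤z x≤y = 0≤y-x⇒x≤y (subst (0# ≤_)
    (solve 3 (λ z x y → z :* (y :- x) := z :* y :- z :* x) refl z x y) (*-nonNeg 0≤z (x≤y⇒0≤y-x x≤y)))

  *-monoʳ-≤-nonNeg : ∀ {z x y} → 0# ≤ z → x ≤ y → x * z ≤ y * z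
  *-monoʳ-≤-nonNeg 0≤z x≤y = subst₂ _≤_ (*-comm _ _) (*-comm _ _) (*-monoˡ-≤-nonNeg 0≤z x≤y)

  pos*neg<0 : ∀ {x y} → 0# < x → y < 0# → x * y < 0#
  pos*neg<0 {x} 0<x y<0 = subst (x * _ <_) (zeroʳ x) (*-monoˡ-<-pos 0<x y<0)

  pos*x≥0⇒x≥0 : ∀ {x y} → 0# < x → 0# ≤ x * y → 0# ≤ y
  pos*x≥0⇒x≥0 {x} {y} 0<x 0≤xy with 0# ≤? y
  ... | yes 0≤y = 0≤y
  ... | no  0≰y = ⊥-elim (<⇒≱ (pos*neg<0 0<x (≰⇒> 0≰y)) 0≤xy)

  neg*pos⊎pos*neg : ∀ {x y} → x * y < 0# → (x < 0# × 0# < y) ⊎ (0# < x × y < 0#)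
  neg*pos⊎pos*neg {x} {y} xy<0 with compare x 0# | compare 0# y
  ... | tri< x<0 _ _ | tri< 0<y _ _ = inj₁ (x<0 , 0<y)
  ... | tri> _ _ 0<x | tri> _ _ y<0 = inj₂ (0<x , y<0)
  ... | tri≈ _ x≡0 _ | _ = ⊥-elim (<-irrefl (subst (_< 0#) (trans (cong (_* y) x≡0) (zeroˡ y)) xy<0))
  ... | _ | tri≈ _ 0≡y _ = ⊥-elim (<-irrefl (subst (_< 0#) (trans (cong (x *_) (sym 0≡y)) (zeroʳ x)) xy<0))
  ... | tri< x<0 _ _ | tri> _ _ y<0 = ⊥-elim (<-asym xy<0
    (subst (0# <_) (solve 2 (λ x y → (:- x) :* (:- y) := x :* y) refl x y) (*-pos (x<0⇒0<-x x<0) (x<0⇒0<-x y<0))))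
  ... | tri> _ _ 0<x | tri< 0<y _ _ = ⊥-elim (<-asym xy<0 (*-pos 0<x 0<y))

  positive-inverse : ∀ {x} → 0# < x → ∃ λ y → (0# < y) × (x * y ≡ 1#)
  positive-inverse {x} 0<x with inverse x (λ x≡0 → <⇒≢ 0<x (sym x≡0))
  ... | y , xy≡1 with compare 0# y
  ... | tri< 0<y _ _ = y , 0<y , xy≡1
  ... | tri≈ _ 0≡y _ = ⊥-elim (0≢1 (trans (sym (zeroʳ x)) (trans (cong (x *_) 0≡y) xy≡1)))
  ... | tri> _ _ y<0 = ⊥-elim (<-asym 0<1 (subst (_< 0#) xy≡1 (pos*neg<0 0<x y<0)))

  pos*x≡0⇒x≡0 : ∀ {x y} → 0# < x → x * y ≡ 0# → y ≡ 0#
  pos*x≡0⇒x≡0 {x} {y} 0<x xy≡0 with positive-inverse 0<x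
  ... | x⁻¹ , _ , xx⁻¹≡1 = begin
    y                ≡⟨ *-identityˡ y ⟨
    1# * y           ≡⟨ cong (_* y) xx⁻¹≡1 ⟨
    (x * x⁻¹) * y    ≡⟨ solve 3 (λ x y x⁻¹ → (x :* x⁻¹) :* y := x⁻¹ :* (x :* y)) refl x y x⁻¹ ⟩
    x⁻¹ * (x * y)    ≡⟨ cong (x⁻¹ *_) xy≡0 ⟩
    x⁻¹ * 0#         ≡⟨ zeroʳ x⁻¹ ⟩
    0#               ∎
    where open ≡-Reasoning

  +*-cancelˡ : ∀ {a d x y} → 0# < d → a + x * d ≡ a + y * d → x ≡ y
  +*-cancelˡ {a} {d} {x} {y} 0<d a+xd≡a+yd = x-y≡0⇒x≡y (pos*x≡0⇒x≡0 0<d (begin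
    d * (x - y)                  ≡⟨ solve 4 (λ a d x y → d :* (x :- y) := (a :+ x :* d) :- (a :+ y :* d)) refl a d x y ⟩
    (a + x * d) - (a + y * d)    ≡⟨ cong (_- (a + y * d)) a+xd≡a+yd ⟩
    (a + y * d) - (a + y * d)    ≡⟨ -‿inverseʳ (a + y * d) ⟩
    0#                           ∎))
    where open ≡-Reasoning

  nonNeg+nonNeg≡0⇒≡0 : ∀ {x y} → 0# ≤ x → 0# ≤ y → x + y ≡ 0# → x ≡ 0#
  nonNeg+nonNeg≡0⇒≡0 (inj₂ 0≡x) _ _       = sym 0≡x
  nonNeg+nonNeg≡0⇒≡0 (inj₁ 0<x) 0≤y x+y≡0 = ⊥-elim (<⇒≢ (+-pos-nonNeg 0<x 0≤y) (sym x+y≡0))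

  combination≡0⇒≡0 : ∀ {t x y} → 0# < t → t < 1# → 0# ≤ x → 0# ≤ y →
                     t * x + (1# - t) * y ≡ 0# → (x ≡ 0#) × (y ≡ 0#)
  combination≡0⇒≡0 {t} {x} {y} 0<t t<1 0≤x 0≤y tx+[1-t]y≡0 =
      pos*x≡0⇒x≡0 0<t (nonNeg+nonNeg≡0⇒≡0 0≤tx 0≤[1-t]y tx+[1-t]y≡0)
    , pos*x≡0⇒x≡0 0<1-t (nonNeg+nonNeg≡0⇒≡0 0≤[1-t]y 0≤tx (trans (+-comm _ _) tx+[1-t]y≡0))
    where
      0<1-t : 0# < 1# - t
      0<1-t = x<y⇒0<y-x t<1
      0≤tx : 0# ≤ t * x
      0≤tx = *-nonNeg (inj₁ 0<t) 0≤x
      0≤[1-t]y : 0# ≤ (1# - t) * y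
      0≤[1-t]y = *-nonNeg (inj₁ 0<1-t) 0≤y

  combination≡1⇒≡1 : ∀ {t x y} → 0# < t → t < 1# → x ≤ 1# → y ≤ 1# →
                     t * x + (1# - t) * y ≡ 1# → (x ≡ 1#) × (y ≡ 1#)
  combination≡1⇒≡1 {t} {x} {y} 0<t t<1 x≤1 y≤1 combination≡1 =
    sym (x-y≡0⇒x≡y (proj₁ complements≡0)) , sym (x-y≡0⇒x≡y (proj₂ complements≡0))
    where
      combination-of-complements≡0 : t * (1# - x) + (1# - t) * (1# - y) ≡ 0#
      combination-of-complements≡0 = begin
        t * (1# - x) + (1# - t) * (1# - y)  ≡⟨ solve 3 (λ t x y → t :* (:1 :- x) :+ (:1 :- t) :* (:1 :- y)
                                                   := :1 :- (t :* x :+ (:1 :- t) :* y)) refl t x y ⟩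
        1# - (t * x + (1# - t) * y)         ≡⟨ cong (λ z → 1# - z) combination≡1 ⟩
        1# - 1#                             ≡⟨ -‿inverseʳ 1# ⟩
        0#                                  ∎
        where open ≡-Reasoning
      complements≡0 : (1# - x ≡ 0#) × (1# - y ≡ 0#)
      complements≡0 = combination≡0⇒≡0 0<t t<1 (x≤y⇒0≤y-x x≤1) (x≤y⇒0≤y-x y≤1) combination-of-complements≡0

  0<2 : 0# < 1# + 1#
  0<2 = +-pos-nonNeg 0<1 0≤1

  ½ : Carrier
  ½ = proj₁ (positive-inverse 0<2)

  0<½ : 0# < ½
  0<½ = proj₁ (proj₂ (positive-inverse 0<2))

  ½+½≡1 : ½ + ½ ≡ 1#
  ½+½≡1 = trans (solve 1 (λ h → h :+ h := (:1 :+ :1) :* h) refl ½) (proj₂ (proj₂ (positive-inverse 0<2)))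

  ½<1 : ½ < 1#
  ½<1 = 0<y-x⇒x<y (subst (0# <_) 1-½≡½ 0<½)
    where
      1-½≡½ : ½ ≡ 1# - ½
      1-½≡½ = trans (solve 1 (λ h → h := h :+ h :- h) refl ½) (cong (_- ½) ½+½≡1)

  ½-midpoint : ∀ x e → ½ * (x + e) + (1# - ½) * (x + - e) ≡ x
  ½-midpoint x e = begin
    ½ * (x + e) + (1# - ½) * (x + - e)  ≡⟨ solve 3 (λ h x e → h :* (x :+ e) :+ (:1 :- h) :* (x :+ :- e)
                                                      := x :+ (h :+ h :- :1) :* e) refl ½ x e ⟩
    x + (½ + ½ - 1#) * e                ≡⟨ cong (λ t → x + (t - 1#) * e) ½+½≡1 ⟩
    x + (1# - 1#) * e                   ≡⟨ solve 2 (λ x e → x :+ (:1 :- :1) :* e := x) refl x e ⟩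
    x                                   ∎
    where open ≡-Reasoning

  x+e≡x-e⇒e≡0 : ∀ {x e} → x + e ≡ x + - e → e ≡ 0#
  x+e≡x-e⇒e≡0 {x} {e} x+e≡x-e = pos*x≡0⇒x≡0 0<2 (begin
    (1# + 1#) * e         ≡⟨ solve 2 (λ x e → (:1 :+ :1) :* e := (x :+ e) :- (x :+ :- e)) refl x e ⟩
    (x + e) - (x + - e)   ≡⟨ cong (_- (x + - e)) x+e≡x-e ⟩
    (x + - e) - (x + - e) ≡⟨ -‿inverseʳ (x + - e) ⟩
    0#                    ∎)
    where open ≡-Reasoning

  nonNeg-factors : ∀ {a b v} → 0# ≤ a * b → 0# < v → v < 1# → 0# ≤ v * b + (1# - v) * a → (0# ≤ a) × (0# ≤ b)
  nonNeg-factors {a} {b} {v} 0≤ab 0<v v<1 0≤combination = ≮⇒≥ a≮0 , ≮⇒≥ b≮0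
    where
      0<1-v : 0# < 1# - v
      0<1-v = x<y⇒0<y-x v<1
      a≮0 : ¬ a < 0#
      a≮0 a<0 = <⇒≱ (subst (v * b + (1# - v) * a <_) (+-identityˡ 0#)
                      (+-mono-≤-< (subst (v * b ≤_) (zeroʳ v) (*-monoˡ-≤-nonNeg (inj₁ 0<v) b≤0)) (pos*neg<0 0<1-v a<0)))
                    0≤combination
        where
          b≤0 : b ≤ 0#
          b≤0 = ≮⇒≥ λ 0<b → <⇒≱ (subst (_< 0#) (*-comm b a) (pos*neg<0 0<b a<0)) 0≤ab
      b≮0 : ¬ b < 0#
      b≮0 b<0 = <⇒≱ (subst (v * b + (1# - v) * a <_) (+-identityʳ 0#)
                      (+-mono-<-≤ (pos*neg<0 0<v b<0)
                                  (subst ((1# - v) * a ≤_) (zeroʳ (1# - v)) (*-monoˡ-≤-nonNeg (inj₁ 0<1-v) a≤0))))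
                    0≤combination
        where
          a≤0 : a ≤ 0#
          a≤0 = ≮⇒≥ λ 0<a → <⇒≱ (pos*neg<0 0<a b<0) 0≤ab

  ¬¬-shift : ∀ {n} {P : Fin n → Set} → (∀ k → ¬ ¬ P k) → ¬ ¬ (∀ k → P k)
  ¬¬-shift {ℕ.zero}  ¬¬P ¬∀P = ¬∀P λ ()
  ¬¬-shift {ℕ.suc n} ¬¬P ¬∀P = ¬¬P Fin.zero λ P₀ → ¬¬-shift (¬¬P ∘ Fin.suc) λ P′ → ¬∀P (Fin.∀-cons P₀ P′)

  fromℕ-suc : ∀ n → fromℕ (ℕ.suc n) ≡ 1# + fromℕ n
  fromℕ-suc = fromℕ-+ 1

  fromℕ-nonNeg : ∀ n → 0# ≤ fromℕ n
  fromℕ-nonNeg ℕ.zero    = ≤-refl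
  fromℕ-nonNeg (ℕ.suc n) = subst (0# ≤_) (sym (fromℕ-suc n)) (+-nonNeg 0≤1 (fromℕ-nonNeg n))

  fromℕ-mono-≤ : ∀ {m n} → m ℕ.≤ n → fromℕ m ≤ fromℕ n
  fromℕ-mono-≤ {m} {n} m≤n = subst₂ _≤_ (+-identityʳ (fromℕ m)) fromℕ[m+[n∸m]]≡fromℕn
    (+-monoʳ-≤ (fromℕ m) (fromℕ-nonNeg (n ℕ.∸ m)))
    where
      fromℕ[m+[n∸m]]≡fromℕn : fromℕ m + fromℕ (n ℕ.∸ m) ≡ fromℕ n
      fromℕ[m+[n∸m]]≡fromℕn = trans (sym (fromℕ-+ m (n ℕ.∸ m))) (cong fromℕ (ℕ.m+[n∸m]≡n m≤n))

  δ*-w≤x⇒0≤x+δ*w : ∀ {x δ w} → δ * - w ≤ x → 0# ≤ x + δ * w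
  δ*-w≤x⇒0≤x+δ*w {x} {δ} {w} δ*-w≤x =
    subst (0# ≤_) (solve 3 (λ x δ w → x :- δ :* (:- w) := x :+ δ :* w) refl x δ w) (x≤y⇒0≤y-x δ*-w≤x)

  δ*w≤1-x⇒x+δ*w≤1 : ∀ {x δ w} → δ * w ≤ 1# - x → x + δ * w ≤ 1#
  δ*w≤1-x⇒x+δ*w≤1 {x} {δ} {w} δ*w≤1-x =
    0≤y-x⇒x≤y (subst (0# ≤_) (solve 3 (λ x δ w → (:1 :- x) :- δ :* w := :1 :- (x :+ δ :* w)) refl x δ w) (x≤y⇒0≤y-x δ*w≤1-x))

  δ*[v-w]≤y-x⇒x+δ*v≤y+δ*w : ∀ {x y δ v w} → δ * (v - w) ≤ y - x → x + δ * v ≤ y + δ * w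
  δ*[v-w]≤y-x⇒x+δ*v≤y+δ*w {x} {y} {δ} {v} {w} bound = 0≤y-x⇒x≤y (subst (0# ≤_)
    (solve 5 (λ x y δ v w → (y :- x) :- δ :* (v :- w) := (y :+ δ :* w) :- (x :+ δ :* v)) refl x y δ v w)
    (x≤y⇒0≤y-x bound))

  -- The supremum s of {0} ∪ {1 | Q} is positive unless Q is refuted.
  weak-excluded-middle : (Q : Set) → Dec (¬ Q)
  weak-excluded-middle Q with completeness S (0# , inj₁ refl) (1# , S≤1)
    where
      S : Carrier → Set
      S x = (x ≡ 0#) ⊎ ((x ≡ 1#) × Q)
      S≤1 : ∀ x → S x → x ≤ 1#
      S≤1 x (inj₁ refl)       = 0≤1
      S≤1 x (inj₂ (refl , _)) = ≤-refl
  ... | s , upper , least with 0# <? s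
  ... | yes 0<s = no λ ¬q → <⇒≱ 0<s (least 0# λ { x (inj₁ refl) → ≤-refl ; x (inj₂ (refl , q)) → ⊥-elim (¬q q) })
  ... | no  0≮s = yes λ q → <⇒≱ 0<1 (≤-trans (upper 1# (inj₂ (refl , q))) (≮⇒≥ 0≮s))

  ≤-stable : ∀ {x y} → ¬ ¬ x ≤ y → x ≤ y
  ≤-stable {x} {y} = decidable-stable (x ≤? y)

  argmin : ∀ {n} (f : Fin n → Carrier) {P : Pred (Fin n) 0ℓ} → Decidable P → ∃ P →
           ∃ λ m → P m × (∀ k → P k → f m ≤ f k)
  argmin {ℕ.suc n} f P? ∃P with Fin.any? (P? ∘ Fin.suc)
  argmin {ℕ.suc n} f P? (Fin.zero , P₀) | no ∄P′ =
    Fin.zero , P₀ , λ { Fin.zero _ → ≤-refl ; (Fin.suc k) Pk → ⊥-elim (∄P′ (k , Pk)) }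
  argmin {ℕ.suc n} f P? (Fin.suc k , Pk) | no ∄P′ = ⊥-elim (∄P′ (k , Pk))
  ... | yes ∃P′ with argmin (f ∘ Fin.suc) (P? ∘ Fin.suc) ∃P′ | P? Fin.zero
  ... | m , Pm , m-min | no ¬P₀ = Fin.suc m , Pm , λ { Fin.zero P₀ → ⊥-elim (¬P₀ P₀) ; (Fin.suc k) → m-min k }
  ... | m , Pm , m-min | yes P₀ with f Fin.zero ≤? f (Fin.suc m)
  ... | yes f₀≤ = Fin.zero , P₀ , λ { Fin.zero _ → ≤-refl ; (Fin.suc k) Pk → ≤-trans f₀≤ (m-min k Pk) }
  ... | no  f₀≰ = Fin.suc m , Pm , λ { Fin.zero _ → inj₁ (≰⇒> f₀≰) ; (Fin.suc k) → m-min k }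

  Eventually : (Carrier → Set) → Set
  Eventually P = ∃ λ ε → (0# < ε) × (∀ δ → 0# < δ → δ ≤ ε → P δ)

  always⇒eventually : ∀ {P} → (∀ δ → 0# < δ → P δ) → Eventually P
  always⇒eventually P = 1# , 0<1 , λ δ 0<δ _ → P δ 0<δ

  eventually-map : ∀ {P Q} → (∀ δ → 0# < δ → P δ → Q δ) → Eventually P → Eventually Q
  eventually-map P⇒Q (ε , 0<ε , P) = ε , 0<ε , λ δ 0<δ δ≤ε → P⇒Q δ 0<δ (P δ 0<δ δ≤ε)

  eventually-× : ∀ {P Q} → Eventually P → Eventually Q → Eventually (λ δ → P δ × Q δ)
  eventually-× (ε₁ , 0<ε₁ , P) (ε₂ , 0<ε₂ , Q) with ε₁ ≤? ε₂
  ... | yes ε₁≤ε₂ = ε₁ , 0<ε₁ , λ δ 0<δ δ≤ε₁ → P δ 0<δ δ≤ε₁ , Q δ 0<δ (≤-trans δ≤ε₁ ε₁≤ε₂)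
  ... | no  ε₁≰ε₂ = ε₂ , 0<ε₂ , λ δ 0<δ δ≤ε₂ → P δ 0<δ (≤-trans δ≤ε₂ (inj₁ (≰⇒> ε₁≰ε₂))) , Q δ 0<δ δ≤ε₂

  eventually-∀ : ∀ {n} {P : Fin n → Carrier → Set} → (∀ k → Eventually (P k)) →
                 Eventually (λ δ → ∀ k → P k δ)
  eventually-∀ {ℕ.zero}  _ = always⇒eventually λ _ _ ()
  eventually-∀ {ℕ.suc n} P = eventually-map (λ _ _ → uncurry Fin.∀-cons)
    (eventually-× (P Fin.zero) (eventually-∀ (λ k → P (Fin.suc k))))

  eventually⇒witness : ∀ {P} → Eventually P → ∃ λ δ → (0# < δ) × P δ
  eventually⇒witness (ε , 0<ε , P) = ε , 0<ε , P ε 0<ε ≤-refl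

  eventually-*-≤ : ∀ x {y} → 0# < y → Eventually (λ δ → δ * x ≤ y)
  eventually-*-≤ x {y} 0<y with 0# <? x
  ... | no  0≮x = always⇒eventually λ δ 0<δ →
    inj₁ (≤-<-trans (subst (δ * x ≤_) (zeroʳ δ) (*-monoˡ-≤-nonNeg (inj₁ 0<δ) (≮⇒≥ 0≮x))) 0<y)
  ... | yes 0<x with positive-inverse 0<x
  ... | x⁻¹ , 0<x⁻¹ , xx⁻¹≡1 = y * x⁻¹ , *-pos 0<y 0<x⁻¹ , λ δ _ δ≤yx⁻¹ →
    subst (δ * x ≤_) (trans (*-assoc y x⁻¹ x) (trans (cong (y *_) (trans (*-comm x⁻¹ x) xx⁻¹≡1)) (*-identityʳ y)))
      (*-monoʳ-≤-nonNeg (inj₁ 0<x) δ≤yx⁻¹)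

  sumFin-cong : ∀ {n} {f g : Fin n → Carrier} → (∀ i → f i ≡ g i) → sumFin f ≡ sumFin g
  sumFin-cong {ℕ.zero}  f≗g = refl
  sumFin-cong {ℕ.suc n} f≗g = cong₂ _+_ (f≗g Fin.zero) (sumFin-cong (λ i → f≗g (Fin.suc i)))

  sumFin-combination : ∀ {n} a b (f g : Fin n → Carrier) →
                       sumFin (λ i → a * f i + b * g i) ≡ a * sumFin f + b * sumFin g
  sumFin-combination {ℕ.zero} a b f g = solve 2 (λ a b → :0 := a :* :0 :+ b :* :0) refl a b
  sumFin-combination {ℕ.suc n} a b f g =
    trans (cong (a * f Fin.zero + b * g Fin.zero +_) (sumFin-combination a b (f ∘ Fin.suc) (g ∘ Fin.suc)))
      (solve 6 (λ a b f₀ g₀ F G → a :* f₀ :+ b :* g₀ :+ (a :* F :+ b :* G) := a :* (f₀ :+ F) :+ b :* (g₀ :+ G))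
         refl a b (f Fin.zero) (g Fin.zero) (sumFin (f ∘ Fin.suc)) (sumFin (g ∘ Fin.suc)))

  sumFin-zero : ∀ {n} {f : Fin n → Carrier} → (∀ i → f i ≡ 0#) → sumFin f ≡ 0#
  sumFin-zero {ℕ.zero}  f≗0 = refl
  sumFin-zero {ℕ.suc n} f≗0 =
    trans (cong₂ _+_ (f≗0 Fin.zero) (sumFin-zero (f≗0 ∘ Fin.suc))) (+-identityʳ 0#)

  sumFin-neg : ∀ {n} (f : Fin n → Carrier) → sumFin (λ i → - f i) ≡ - sumFin f
  sumFin-neg {ℕ.zero}  f = sym -0#≈0#
  sumFin-neg {ℕ.suc n} f = trans (cong (- f Fin.zero +_) (sumFin-neg (f ∘ Fin.suc))) (⁻¹-∙-comm _ _)

  sumFin-update : ∀ {n} (f g : Fin n → Carrier) i → (∀ k → ¬ k ≡ i → f k ≡ g k) →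
                  sumFin f ≡ sumFin g + (f i - g i)
  sumFin-update f g Fin.zero f≈g = begin
    f Fin.zero + sumFin (f ∘ Fin.suc)  ≡⟨ cong (f Fin.zero +_) (sumFin-cong (λ k → f≈g (Fin.suc k) λ ())) ⟩
    f Fin.zero + sumFin (g ∘ Fin.suc)  ≡⟨ solve 3 (λ f₀ g₀ G → f₀ :+ G := g₀ :+ G :+ (f₀ :- g₀))
                                           refl (f Fin.zero) (g Fin.zero) (sumFin (g ∘ Fin.suc)) ⟩
    sumFin g + (f Fin.zero - g Fin.zero) ∎
    where open ≡-Reasoning
  sumFin-update f g (Fin.suc i) f≈g = begin
    f Fin.zero + sumFin (f ∘ Fin.suc)
      ≡⟨ cong₂ _+_ (f≈g Fin.zero λ ()) (sumFin-update (f ∘ Fin.suc) (g ∘ Fin.suc) i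
                                          (λ k k≢i → f≈g (Fin.suc k) (k≢i ∘ Fin.suc-injective))) ⟩
    g Fin.zero + (sumFin (g ∘ Fin.suc) + (f (Fin.suc i) - g (Fin.suc i)))
      ≡⟨ sym (+-assoc _ _ _) ⟩
    sumFin g + (f (Fin.suc i) - g (Fin.suc i)) ∎
    where open ≡-Reasoning

  lin-cong : ∀ {n} (c : Point n) {x y : Point n} → (∀ i → x i ≡ y i) → lin c x ≡ lin c y
  lin-cong c x≗y = sumFin-cong (λ i → cong (c i *_) (x≗y i))

  lin-combination : ∀ {n} (c : Point n) a b (x y : Point n) →
                    lin c (λ i → a * x i + b * y i) ≡ a * lin c x + b * lin c y
  lin-combination c a b x y = trans
    (sumFin-cong (λ i → solve 5 (λ c a b x y → c :* (a :* x :+ b :* y) := a :* (c :* x) :+ b :* (c :* y))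
                          refl (c i) a b (x i) (y i)))
    (sumFin-combination a b (λ i → c i * x i) (λ i → c i * y i))

  lin-zero : ∀ {n} (c x : Point n) → (∀ i → x i ≡ 0#) → lin c x ≡ 0#
  lin-zero c x x≗0 = sumFin-zero (λ i → trans (cong (c i *_) (x≗0 i)) (zeroʳ (c i)))

  negate : ∀ {n} → Point n → Point n
  negate c i = - c i

  lin-negateˡ : ∀ {n} (c x : Point n) → lin (negate c) x ≡ - lin c x
  lin-negateˡ c x = trans (sumFin-cong (λ i → sym (-‿distribˡ-* (c i) (x i)))) (sumFin-neg (λ i → c i * x i))

  lin-shift : ∀ {n} (c x w : Point n) δ → lin c (λ k → x k + δ * w k) ≡ lin c x + δ * lin c w
  lin-shift c x w δ = trans (lin-cong c (λ k → cong (_+ δ * w k) (sym (*-identityˡ (x k)))))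
    (trans (lin-combination c 1# δ x w) (cong (_+ δ * lin c w) (*-identityˡ (lin c x))))

  lin-negateʳ : ∀ {n} (c x : Point n) → lin c (negate x) ≡ - lin c x
  lin-negateʳ c x = trans (sumFin-cong (λ i → sym (-‿distribʳ-* (c i) (x i)))) (sumFin-neg (λ i → c i * x i))

  root⇒negate-root : ∀ {n} (c : Point n) {x} → lin c x ≡ 0# → lin (negate c) x ≡ 0#
  root⇒negate-root c {x} hx≡0 = trans (lin-negateˡ c x) (trans (cong -_ hx≡0) -0#≈0#)

  negate-root⇒root : ∀ {n} (c : Point n) {x} → lin (negate c) x ≡ 0# → lin c x ≡ 0#
  negate-root⇒root c {x} -hx≡0 =
    trans (sym (-‿involutive (lin c x))) (trans (cong -_ (trans (sym (lin-negateˡ c x)) -hx≡0)) -0#≈0#)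

  -- The root s = h(p) / (h(p) − h(q)) of h on the segment from p to q.
  root-on-segment : ∀ {n} (c p q : Point n) → 0# < lin c p → lin c q < 0# →
                    ∃ λ s → (0# < s) × (s < 1#) × (lin c (λ k → s * q k + (1# - s) * p k) ≡ 0#)
  root-on-segment c p q 0<hp hq<0 with positive-inverse (x<y⇒0<y-x (<-trans hq<0 0<hp))
  ... | D⁻¹ , 0<D⁻¹ , DD⁻¹≡1 = s , *-pos 0<hp 0<D⁻¹ , s<1 , root
    where
      a b s : Carrier
      a = lin c p
      b = lin c q
      s = a * D⁻¹
      1-s≡-bD⁻¹ : 1# - s ≡ (- b) * D⁻¹
      1-s≡-bD⁻¹ = trans (cong (_- s) (sym DD⁻¹≡1)) (solve 3 (λ a b i → (a :- b) :* i :- a :* i := (:- b) :* i) refl a b D⁻¹)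
      s<1 : s < 1#
      s<1 = 0<y-x⇒x<y (subst (0# <_) (sym 1-s≡-bD⁻¹) (*-pos (x<0⇒0<-x hq<0) 0<D⁻¹))
      root : lin c (λ k → s * q k + (1# - s) * p k) ≡ 0#
      root = begin
        lin c (λ k → s * q k + (1# - s) * p k)  ≡⟨ lin-combination c s (1# - s) q p ⟩
        s * b + (1# - s) * a                    ≡⟨ cong (λ r → s * b + r * a) 1-s≡-bD⁻¹ ⟩
        a * D⁻¹ * b + (- b) * D⁻¹ * a           ≡⟨ solve 3 (λ a b i → a :* i :* b :+ (:- b) :* i :* a := :0) refl a b D⁻¹ ⟩
        0#                                      ∎
        where open ≡-Reasoning

  lin-update : ∀ {n} (c x y : Point n) i → (∀ k → ¬ k ≡ i → x k ≡ y k) →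
               lin c x ≡ lin c y + c i * (x i - y i)
  lin-update c x y i x≈y = trans
    (sumFin-update (λ k → c k * x k) (λ k → c k * y k) i (λ k k≢i → cong (c k *_) (x≈y k k≢i)))
    (cong (lin c y +_) (sym (x[y-z]≈xy-xz (c i) (x i) (y i))))

module DecidableSubset {n : ℕ} {P : Pred (Fin n) 0ℓ} (P? : Decidable P) where

  subset : Subset n
  subset = tabulate (does ∘ P?)

  ∈-subset⁺ : ∀ {k} → P k → k ∈ subset
  ∈-subset⁺ {k} Pk = lookup⇒[]= k subset (trans (lookup∘tabulate (does ∘ P?) k) (dec-true (P? k) Pk))

  ∈-subset⁻ : ∀ {k} → k ∈ subset → P k
  ∈-subset⁻ {k} k∈ = from-does (P? k) (trans (sym (lookup∘tabulate (does ∘ P?) k)) ([]=⇒lookup k∈))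
    where
      from-does : ∀ {A : Set} (A? : Dec A) → does A? ≡ true → A
      from-does (yes a) _ = a

x∈p─q⇒x∉q : ∀ {n} (p q : Subset n) {x} → x ∈ p ─ q → x ∉ q
x∈p─q⇒x∉q (_ ∷ p) (outside ∷ q) here       ()
x∈p─q⇒x∉q (_ ∷ p) (_       ∷ q) (there x∈) (there x∈q) = x∈p─q⇒x∉q p q x∈ x∈q

module Comparability (R : RealField) {d : ℕ} (_≼_ : Rel (Fin d) 0ℓ) where
  open Geometry.PosetStuff R _≼_

  Comparable : Rel (Fin d) 0ℓ
  Comparable i j = i ≼ j ⊎ j ≼ i

  comparable-sym : ∀ {i j} → Comparable i j → Comparable j i
  comparable-sym (inj₁ i≼j) = inj₂ i≼j
  comparable-sym (inj₂ j≼i) = inj₁ j≼i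

  path-⊆ : ∀ {V W} → V ⊆ W → ∀ {i j} → Path V i j → Path W i j
  path-⊆ V⊆W here               = here
  path-⊆ V⊆W (step p k∈V j~k)   = step (path-⊆ V⊆W p) (V⊆W k∈V) j~k

  path-end∈ : ∀ {W i j} → Path W i j → i ∈ W → j ∈ W
  path-end∈ here             i∈W = i∈W
  path-end∈ (step _ k∈W _)   _   = k∈W

  _++ᵖ_ : ∀ {W i j k} → Path W i j → Path W j k → Path W i k
  p ++ᵖ here             = p
  p ++ᵖ step q l∈W k~l   = step (p ++ᵖ q) l∈W k~l

  reverse : ∀ {W i j} → Path W i j → i ∈ W → Path W j i
  reverse here             _   = here
  reverse (step p k∈W j~k) i∈W = step here (path-end∈ p i∈W) (comparable-sym j~k) ++ᵖ reverse p i∈W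

  constant-along-paths : ∀ {A : Set} (f : Fin d → A) {W} →
                         (∀ {u v} → u ∈ W → v ∈ W → Comparable u v → f u ≡ f v) →
                         ∀ {a k} → a ∈ W → Path W a k → f k ≡ f a
  constant-along-paths f f-resp a∈W here               = refl
  constant-along-paths f f-resp a∈W (step p k∈W j~k) =
    trans (sym (f-resp (path-end∈ p a∈W) k∈W j~k)) (constant-along-paths f f-resp a∈W p)

  ∈-symDiff⁻ : ∀ I J {k} → k ∈ symDiff I J → (k ∈ I × k ∉ J) ⊎ (k ∈ J × k ∉ I)
  ∈-symDiff⁻ I J k∈ with x∈p∪q⁻ (I ─ J) (J ─ I) k∈
  ... | inj₁ k∈I─J = inj₁ (p─q⊆p I J k∈I─J , x∈p─q⇒x∉q I J k∈I─J)
  ... | inj₂ k∈J─I = inj₂ (p─q⊆p J I k∈J─I , x∈p─q⇒x∉q J I k∈J─I)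

  ∈-symDiff⁺ : ∀ I J {k} → (k ∈ I × k ∉ J) ⊎ (k ∈ J × k ∉ I) → k ∈ symDiff I J
  ∈-symDiff⁺ I J (inj₁ (k∈I , k∉J)) = x∈p∪q⁺ (inj₁ (x∈p∧x∉q⇒x∈p─q k∈I k∉J))
  ∈-symDiff⁺ I J (inj₂ (k∈J , k∉I)) = x∈p∪q⁺ (inj₂ (x∈p∧x∉q⇒x∈p─q k∈J k∉I))

  symDiff-comm : ∀ I J → symDiff I J ⊆ symDiff J I
  symDiff-comm I J k∈ = ∈-symDiff⁺ J I (Data.Sum.swap (∈-symDiff⁻ I J k∈))

  connected-symDiff-comm : ∀ I J → Connected (symDiff I J) → Connected (symDiff J I)
  connected-symDiff-comm I J connected i j i∈ j∈ =
    path-⊆ (symDiff-comm I J) (connected i j (symDiff-comm J I i∈) (symDiff-comm J I j∈))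

  -- A path leaving I ∖ J must pass through a comparable pair in (I ∖ J) × (J ∖ I),
  -- which is impossible for ideals.
  connected-symDiff⇒nested : ∀ {I J} → IsIdeal I → IsIdeal J → Connected (symDiff I J) → I ⊆ J ⊎ J ⊆ I
  connected-symDiff⇒nested {I} {J} I-ideal J-ideal connected
    with Fin.any? (λ k → k ∈? I ×-dec ¬? (k ∈? J))
  ... | no ∄k = inj₁ λ {k} k∈I → decidable-stable (k ∈? J) (λ k∉J → ∄k (k , k∈I , k∉J))
  ... | yes (a , a∈I , a∉J) with Fin.any? (λ k → k ∈? J ×-dec ¬? (k ∈? I))
  ...   | no ∄k = inj₂ λ {k} k∈J → decidable-stable (k ∈? I) (λ k∉I → ∄k (k , k∈J , k∉I))
  ...   | yes (b , b∈J , b∉I) =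
    ⊥-elim (proj₂ (stays-in-I─J (connected a b (∈-symDiff⁺ I J (inj₁ (a∈I , a∉J)))
                                               (∈-symDiff⁺ I J (inj₂ (b∈J , b∉I))))) b∈J)
    where
      stays-in-I─J : ∀ {k} → Path (symDiff I J) a k → k ∈ I × k ∉ J
      stays-in-I─J here = a∈I , a∉J
      stays-in-I─J (step {j} {k} p k∈ j~k) with stays-in-I─J p | ∈-symDiff⁻ I J k∈
      ... | _           | inj₁ k∈I─J        = k∈I─J
      ... | j∈I , j∉J   | inj₂ (k∈J , k∉I) with j~k
      ...   | inj₁ j≼k = ⊥-elim (j∉J (J-ideal k j k∈J j≼k))
      ...   | inj₂ k≼j = ⊥-elim (k∉I (I-ideal j k j∈I k≼j))

module OrderPolytopeBasics (R : RealField) {d : ℕ} (_≼_ : Rel (Fin d) 0ℓ) (po : IsPartialOrder _≡_ _≼_) where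
  open OrderedField R
  open PosetStuff _≼_
  open Comparability R _≼_
  private module ≼ = IsPartialOrder po

  O : Point d → Set
  O = OrderPolytope

  ρ-∈ : ∀ {W : Subset d} {k} → k ∈ W → ρ W k ≡ 1#
  ρ-∈ k∈W rewrite []=⇒lookup k∈W = refl

  ρ-∉ : ∀ {W : Subset d} {k} → k ∉ W → ρ W k ≡ 0#
  ρ-∉ {W} {k} k∉W with lookup W k in lookup≡
  ... | true  = ⊥-elim (k∉W (lookup⇒[]= k W lookup≡))
  ... | false = refl

  ρ-bounded : ∀ (W : Subset d) k → (0# ≤ ρ W k) × (ρ W k ≤ 1#)
  ρ-bounded W k with lookup W k
  ... | true  = 0≤1 , ≤-refl
  ... | false = ≤-refl , 0≤1

  ideal⇒ρ∈O : ∀ {I : Subset d} → IsIdeal I → O (ρ I)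
  ideal⇒ρ∈O {I} I-ideal = ρ-bounded I , antitone
    where
      antitone : ∀ i j → i ≼ j → ρ I j ≤ ρ I i
      antitone i j i≼j with j ∈? I
      ... | yes j∈I = subst (ρ I j ≤_) (sym (ρ-∈ (I-ideal j i j∈I i≼j))) (proj₂ (ρ-bounded I j))
      ... | no  j∉I = subst (_≤ ρ I i) (sym (ρ-∉ j∉I)) (proj₁ (ρ-bounded I i))

  O-convex : ∀ {x y t} → O x → O y → 0# ≤ t → t ≤ 1# → O (λ k → t * x k + (1# - t) * y k)
  O-convex {x} {y} {t} (x-bounded , x-antitone) (y-bounded , y-antitone) 0≤t t≤1 =
    (λ k → lower k , upper k) , antitone
    where
      0≤1-t : 0# ≤ 1# - t
      0≤1-t = x≤y⇒0≤y-x t≤1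
      lower : ∀ k → 0# ≤ t * x k + (1# - t) * y k
      lower k = +-nonNeg (*-nonNeg 0≤t (proj₁ (x-bounded k))) (*-nonNeg 0≤1-t (proj₁ (y-bounded k)))
      upper : ∀ k → t * x k + (1# - t) * y k ≤ 1#
      upper k = subst (t * x k + (1# - t) * y k ≤_) (solve 1 (λ t → t :* :1 :+ (:1 :- t) :* :1 := :1) refl t)
        (+-mono-≤ (*-monoˡ-≤-nonNeg 0≤t (proj₂ (x-bounded k))) (*-monoˡ-≤-nonNeg 0≤1-t (proj₂ (y-bounded k))))
      antitone : ∀ i j → i ≼ j → t * x j + (1# - t) * y j ≤ t * x i + (1# - t) * y i
      antitone i j i≼j =
        +-mono-≤ (*-monoˡ-≤-nonNeg 0≤t (x-antitone i j i≼j)) (*-monoˡ-≤-nonNeg 0≤1-t (y-antitone i j i≼j))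

  -- The ¬¬-closure of ≼ is again a partial order and, unlike ≼, decidable
  -- (by weak excluded middle); it stands in for ≼ wherever the argument must
  -- decide comparabilities.
  _⊑_ : Rel (Fin d) 0ℓ
  i ⊑ j = ¬ ¬ i ≼ j

  _⊑?_ : ∀ i j → Dec (i ⊑ j)
  i ⊑? j = weak-excluded-middle (¬ i ≼ j)

  ≼⇒⊑ : ∀ {i j} → i ≼ j → i ⊑ j
  ≼⇒⊑ i≼j i⋠j = i⋠j i≼j

  ⊑-refl : ∀ {i} → i ⊑ i
  ⊑-refl = ≼⇒⊑ ≼.refl

  ⊑-trans : ∀ {i j k} → i ⊑ j → j ⊑ k → i ⊑ k
  ⊑-trans i⊑j j⊑k i⋠k = i⊑j λ i≼j → j⊑k λ j≼k → i⋠k (≼.trans i≼j j≼k)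

  ⊑-antisym : ∀ {i j} → i ⊑ j → j ⊑ i → i ≡ j
  ⊑-antisym {i} {j} i⊑j j⊑i = decidable-stable (i Fin.≟ j) λ i≢j → i⊑j λ i≼j → j⊑i λ j≼i → i≢j (≼.antisym i≼j j≼i)

  module ⊑ = PosetStuff _⊑_

  ⊑-ideal⇒ideal : ∀ {I} → ⊑.IsIdeal I → IsIdeal I
  ⊑-ideal⇒ideal I-ideal i j i∈I j≼i = I-ideal i j i∈I (≼⇒⊑ j≼i)

  ⊑-ideal? : ∀ I → Dec (⊑.IsIdeal I)
  ⊑-ideal? I = Fin.all? λ i → Fin.all? λ j → i ∈? I →-dec (j ⊑? i →-dec j ∈? I)

  O-antitone-⊑ : ∀ {y} → O y → ∀ j k → j ⊑ k → y k ≤ y j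
  O-antitone-⊑ (_ , y-antitone) j k j⊑k = ≤-stable λ y[k]≰y[j] → j⊑k λ j≼k → y[k]≰y[j] (y-antitone j k j≼k)

  OrderCone : Point d → Set
  OrderCone y = (∀ k → 0# ≤ y k) × (∀ j k → j ⊑ k → y k ≤ y j)

  O⊆OrderCone : ∀ {y} → O y → OrderCone y
  O⊆OrderCone O-y = (λ k → proj₁ (proj₁ O-y k)) , O-antitone-⊑ O-y

  support : Point d → Subset d
  support y = DecidableSubset.subset (λ k → ¬? (y k ≟ 0#))

  ∈-support⁺ : ∀ {y k} → ¬ y k ≡ 0# → k ∈ support y
  ∈-support⁺ {y} = DecidableSubset.∈-subset⁺ (λ k → ¬? (y k ≟ 0#))

  ∈-support⁻ : ∀ {y k} → k ∈ support y → ¬ y k ≡ 0#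
  ∈-support⁻ {y} = DecidableSubset.∈-subset⁻ (λ k → ¬? (y k ≟ 0#))

  ∉-support : ∀ {y k} → k ∉ support y → y k ≡ 0#
  ∉-support {y} {k} k∉ = decidable-stable (y k ≟ 0#) (k∉ ∘ ∈-support⁺)

  support-ideal : ∀ {y} → OrderCone y → ⊑.IsIdeal (support y)
  support-ideal {y} (y≥0 , y-antitone) i j i∈ j⊑i = ∈-support⁺ λ y[j]≡0 →
    ∈-support⁻ i∈ (≤-antisym (subst (y i ≤_) y[j]≡0 (y-antitone j i j⊑i)) (y≥0 i))

  -- Removing the layer v · ρ(support y), where v is the least nonzero value of y,
  -- stays in the cone and strictly shrinks the support.
  module BottomLayer {y} (y∈cone : OrderCone y) (m : Fin d) (m∈N : m ∈ support y)
                     (m-min : ∀ k → k ∈ support y → y m ≤ y k) where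
    N : Subset d
    N = support y

    v : Carrier
    v = y m

    0<v : 0# < v
    0<v = ≤∧≢⇒< (proj₁ y∈cone m) (∈-support⁻ m∈N ∘ sym)

    z : Point d
    z k = y k - v * ρ N k

    z-∈ : ∀ {k} → k ∈ N → z k ≡ y k - v
    z-∈ {k} k∈N = trans (cong (λ r → y k - v * r) (ρ-∈ k∈N)) (cong (λ u → y k - u) (*-identityʳ v))

    z-∉ : ∀ {k} → k ∉ N → z k ≡ 0#
    z-∉ {k} k∉N = begin
      y k - v * ρ N k  ≡⟨ cong₂ (λ a r → a - v * r) (∉-support k∉N) (ρ-∉ k∉N) ⟩
      0# - v * 0#      ≡⟨ solve 1 (λ v → :0 :- v :* :0 := :0) refl v ⟩
      0#               ∎
      where open ≡-Reasoning

    z≥0 : ∀ k → 0# ≤ z k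
    z≥0 k with k ∈? N
    ... | yes k∈N = subst (0# ≤_) (sym (z-∈ k∈N)) (x≤y⇒0≤y-x (m-min k k∈N))
    ... | no  k∉N = inj₂ (sym (z-∉ k∉N))

    z∈cone : OrderCone z
    z∈cone = z≥0 , z-antitone
      where
        z-antitone : ∀ j k → j ⊑ k → z k ≤ z j
        z-antitone j k j⊑k with k ∈? N
        ... | yes k∈N = subst₂ _≤_ (sym (z-∈ k∈N)) (sym (z-∈ (support-ideal y∈cone k j k∈N j⊑k)))
                                   (+-monoˡ-≤ (- v) (proj₂ y∈cone j k j⊑k))
        ... | no  k∉N = subst (_≤ z j) (sym (z-∉ k∉N)) (z≥0 j)

    support-z⊂N : support z ⊂ N
    support-z⊂N = (λ {k} k∈ → decidable-stable (k ∈? N) (∈-support⁻ k∈ ∘ z-∉))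
                , m , m∈N , λ m∈ → ∈-support⁻ m∈ (trans (z-∈ m∈N) (-‿inverseʳ v))

    lin-y≡lin-z+v*lin-ρN : ∀ c → lin c y ≡ lin c z + v * lin c (ρ N)
    lin-y≡lin-z+v*lin-ρN c = begin
      lin c y                            ≡⟨ lin-cong c (λ k → solve 3 (λ y v r → y := :1 :* (y :- v :* r) :+ v :* r)
                                                                   refl (y k) v (ρ N k)) ⟩
      lin c (λ k → 1# * z k + v * ρ N k) ≡⟨ lin-combination c 1# v z (ρ N) ⟩
      1# * lin c z + v * lin c (ρ N)     ≡⟨ cong (_+ v * lin c (ρ N)) (*-identityˡ (lin c z)) ⟩
      lin c z + v * lin c (ρ N)          ∎
      where open ≡-Reasoning

  nonNeg-on-ideals⇒nonNeg-on-cone : ∀ c → (∀ I → ⊑.IsIdeal I → 0# ≤ lin c (ρ I)) →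
                                     ∀ {y} → OrderCone y → 0# ≤ lin c y
  nonNeg-on-ideals⇒nonNeg-on-cone c nonNeg-on-ideals {y} y∈cone =
    by-support-size (ℕ.suc d) y∈cone (ℕ.s≤s (∣p∣≤n (support y)))
    where
      by-support-size : ∀ n {y} → OrderCone y → ∣ support y ∣ ℕ.< n → 0# ≤ lin c y
      by-support-size (ℕ.suc n) {y} y∈cone (ℕ.s≤s ∣N∣≤n) with Fin.any? (λ k → k ∈? support y)
      ... | no ∄k = inj₂ (sym (lin-zero c y λ k → ∉-support λ k∈N → ∄k (k , k∈N)))
      ... | yes ∃k with argmin y (λ k → k ∈? support y) ∃k
      ... | m , m∈N , m-min = subst (0# ≤_) (sym (lin-y≡lin-z+v*lin-ρN c))
            (+-nonNeg (by-support-size n z∈cone (ℕ.<-≤-trans (p⊂q⇒∣p∣<∣q∣ support-z⊂N) ∣N∣≤n))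
                      (*-nonNeg (inj₁ 0<v) (nonNeg-on-ideals N (support-ideal y∈cone))))
        where open BottomLayer y∈cone m m∈N m-min

  -- Pushing the root x of h away from y stays in S, so h(y) ≤ 0 forces h(y) ≥ 0.
  relint-root⇒zero : ∀ {S : Point d → Set} c {x} → InRelInt S x → lin c x ≡ 0# →
                     (∀ y → S y → lin c y ≤ 0#) → ∀ y → S y → lin c y ≡ 0#
  relint-root⇒zero {S} c {x} (_ , prolong) hx≡0 nonPos y S-y with prolong y S-y
  ... | ε , 0<ε , S-x′ = ≤-antisym (nonPos y S-y) (pos*x≥0⇒x≥0 0<ε (-x≤0⇒0≤x (subst (_≤ 0#) h[x′]≡-εh[y] (nonPos _ S-x′))))
    where
      h[x′]≡-εh[y] : lin c (λ k → x k + ε * (x k - y k)) ≡ - (ε * lin c y)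
      h[x′]≡-εh[y] = begin
        lin c (λ k → x k + ε * (x k - y k))
          ≡⟨ lin-cong c (λ k → solve 3 (λ x y ε → x :+ ε :* (x :- y) := (:1 :+ ε) :* x :+ (:- ε) :* y) refl (x k) (y k) ε) ⟩
        lin c (λ k → (1# + ε) * x k + (- ε) * y k)   ≡⟨ lin-combination c (1# + ε) (- ε) x y ⟩
        (1# + ε) * lin c x + (- ε) * lin c y         ≡⟨ cong (λ h → (1# + ε) * h + (- ε) * lin c y) hx≡0 ⟩
        (1# + ε) * 0# + (- ε) * lin c y
          ≡⟨ solve 2 (λ ε h → (:1 :+ ε) :* :0 :+ (:- ε) :* h := :- (ε :* h)) refl ε (lin c y) ⟩
        - (ε * lin c y)                              ∎
        where open ≡-Reasoning

  module ↓  (i : Fin d) = DecidableSubset (λ k → k ⊑? i)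
  module ↓⁻ (i : Fin d) = DecidableSubset (λ k → k ⊑? i ×-dec ¬? (k Fin.≟ i))

  ↓ ↓⁻ : Fin d → Subset d
  ↓  = ↓.subset
  ↓⁻ = ↓⁻.subset

  ↓-ideal : ∀ i → ⊑.IsIdeal (↓ i)
  ↓-ideal i k j k∈ j⊑k = ↓.∈-subset⁺ i (⊑-trans j⊑k (↓.∈-subset⁻ i k∈))

  ↓⁻-ideal : ∀ i → ⊑.IsIdeal (↓⁻ i)
  ↓⁻-ideal i k j k∈ j⊑k with ↓⁻.∈-subset⁻ i k∈
  ... | k⊑i , k≢i = ↓⁻.∈-subset⁺ i (⊑-trans j⊑k k⊑i , λ { refl → k≢i (⊑-antisym k⊑i j⊑k) })

  ↓-∖-↓⁻ : ∀ i k → ¬ k ≡ i → ρ (↓ i) k ≡ ρ (↓⁻ i) k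
  ↓-∖-↓⁻ i k k≢i with k ∈? ↓ i
  ... | yes k∈ = trans (ρ-∈ k∈) (sym (ρ-∈ (↓⁻.∈-subset⁺ i (↓.∈-subset⁻ i k∈ , k≢i))))
  ... | no  k∉ = trans (ρ-∉ k∉) (sym (ρ-∉ (k∉ ∘ ↓.∈-subset⁺ i ∘ proj₁ ∘ ↓⁻.∈-subset⁻ i)))

  zero-on-ideals⇒zero : ∀ c → (∀ I → ⊑.IsIdeal I → lin c (ρ I) ≡ 0#) → ∀ i → c i ≡ 0#
  zero-on-ideals⇒zero c zero-on-ideals i = begin
    c i                                            ≡⟨ solve 1 (λ c → c := :0 :+ c :* (:1 :- :0)) refl (c i) ⟩
    0# + c i * (1# - 0#)
      ≡⟨ cong₂ (λ h r → h + c i * r) (sym (zero-on-ideals (↓⁻ i) (↓⁻-ideal i)))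
               (cong₂ _-_ (sym (ρ-∈ (↓.∈-subset⁺ i ⊑-refl))) (sym (ρ-∉ (λ i∈ → proj₂ (↓⁻.∈-subset⁻ i i∈) refl)))) ⟩
    lin c (ρ (↓⁻ i)) + c i * (ρ (↓ i) i - ρ (↓⁻ i) i) ≡⟨ sym (lin-update c (ρ (↓ i)) (ρ (↓⁻ i)) i (↓-∖-↓⁻ i)) ⟩
    lin c (ρ (↓ i))                                ≡⟨ zero-on-ideals (↓ i) (↓-ideal i) ⟩
    0#                                             ∎
    where open ≡-Reasoning

  nonPos-on-ideals⇒nonPos : ∀ c → (∀ I → ⊑.IsIdeal I → lin c (ρ I) ≤ 0#) → ∀ y → O y → lin c y ≤ 0#
  nonPos-on-ideals⇒nonPos c nonPos-on-ideals y O-y = 0≤-x⇒x≤0 (subst (0# ≤_) (lin-negateˡ c y)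
    (nonNeg-on-ideals⇒nonNeg-on-cone (negate c)
      (λ I I-ideal → subst (0# ≤_) (sym (lin-negateˡ c (ρ I))) (x≤0⇒0≤-x (nonPos-on-ideals I I-ideal)))
      (O⊆OrderCone O-y)))

  relint-root⇒positive-ideal : ∀ c → ¬ (∀ i → c i ≡ 0#) → ∀ {x} → InRelInt O x → lin c x ≡ 0# →
                               ∃ λ I → IsIdeal I × (0# < lin c (ρ I))
  relint-root⇒positive-ideal c c≢0 x-relint hx≡0 with anySubset? (λ I → ⊑-ideal? I ×-dec (0# <? lin c (ρ I)))
  ... | yes (I , I-ideal , 0<hI) = I , ⊑-ideal⇒ideal I-ideal , 0<hI
  ... | no  ∄I = ⊥-elim (c≢0 (zero-on-ideals⇒zero c λ I I-ideal →
          relint-root⇒zero c x-relint hx≡0 (nonPos-on-ideals⇒nonPos c nonPos) (ρ I) (ideal⇒ρ∈O (⊑-ideal⇒ideal I-ideal))))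
    where
      nonPos : ∀ I → ⊑.IsIdeal I → lin c (ρ I) ≤ 0#
      nonPos I I-ideal = ≮⇒≥ λ 0<hI → ∄I (I , I-ideal , 0<hI)

  relint-root⇒negative-ideal : ∀ c → ¬ (∀ i → c i ≡ 0#) → ∀ {x} → InRelInt O x → lin c x ≡ 0# →
                               ∃ λ I → IsIdeal I × (lin c (ρ I) < 0#)
  relint-root⇒negative-ideal c c≢0 x-relint hx≡0
    with relint-root⇒positive-ideal (negate c) (c≢0 ∘ negate≡0⇒≡0) x-relint (root⇒negate-root c hx≡0)
    where
      negate≡0⇒≡0 : (∀ i → - c i ≡ 0#) → ∀ i → c i ≡ 0#
      negate≡0⇒≡0 -c≡0 i = trans (sym (-‿involutive (c i))) (trans (cong -_ (-c≡0 i)) -0#≈0#)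
  ... | I , I-ideal , 0<-hI = I , I-ideal , 0<-x⇒x<0 (subst (0# <_) (lin-negateˡ c (ρ I)) 0<-hI)

  UpperHalf LowerHalf : Point d → Point d → Set
  UpperHalf c y = O y × (0# ≤ lin c y)
  LowerHalf c y = O y × (lin c y ≤ 0#)

  PreservesUpperVertices : Point d → Set
  PreservesUpperVertices c = ∀ x → IsVertex (UpperHalf c) x → IsVertex O x

  SignCondition : Point d → Set
  SignCondition c = ∀ I J → IsIdeal I → IsIdeal J → Connected (symDiff I J) → 0# ≤ lin c (ρ I) * lin c (ρ J)

  IsVertex-resp : ∀ {S T : Point d → Set} → (∀ y → S y → T y) → (∀ y → T y → S y) →
                  ∀ {x} → IsVertex S x → IsVertex T x
  IsVertex-resp S⇒T T⇒S (S-x , extreme) = S⇒T _ S-x , λ y z t T-y T-z → extreme y z t (T⇒S y T-y) (T⇒S z T-z)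

  LowerHalf⇒UpperHalf-negate : ∀ c y → LowerHalf c y → UpperHalf (negate c) y
  LowerHalf⇒UpperHalf-negate c y (y∈O , hy≤0) = y∈O , subst (0# ≤_) (sym (lin-negateˡ c y)) (x≤0⇒0≤-x hy≤0)

  UpperHalf-negate⇒LowerHalf : ∀ c y → UpperHalf (negate c) y → LowerHalf c y
  UpperHalf-negate⇒LowerHalf c y (y∈O , 0≤-hy) = y∈O , 0≤-x⇒x≤0 (subst (0# ≤_) (lin-negateˡ c y) 0≤-hy)

  -- y and z are antitone, so both differences along the pair are nonnegative
  -- and their combination, the difference of x, vanishes.
  split-level-pair : ∀ {x y z : Point d} {s} → O y → O z → 0# < s → s < 1# → (∀ k → x k ≡ s * y k + (1# - s) * z k) →
                     ∀ {u v} → Comparable u v → x u ≡ x v → (y u ≡ y v) × (z u ≡ z v)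
  split-level-pair {x} {y} {z} {s} O-y O-z 0<s s<1 x≡ {u} {v} (inj₁ u≼v) xu≡xv =
    x-y≡0⇒x≡y (proj₁ differences-vanish) , x-y≡0⇒x≡y (proj₂ differences-vanish)
    where
      combination-of-differences≡0 : s * (y u - y v) + (1# - s) * (z u - z v) ≡ 0#
      combination-of-differences≡0 = begin
        s * (y u - y v) + (1# - s) * (z u - z v)
          ≡⟨ cong₂ _+_ (x[y-z]≈xy-xz s (y u) (y v)) (x[y-z]≈xy-xz (1# - s) (z u) (z v)) ⟩
        (s * y u - s * y v) + ((1# - s) * z u - (1# - s) * z v)
          ≡⟨ [x+y]-[u+v]≡[x-u]+[y-v] _ _ _ _ ⟨
        (s * y u + (1# - s) * z u) - (s * y v + (1# - s) * z v)
          ≡⟨ cong₂ _-_ (x≡ u) (x≡ v) ⟨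
        x u - x v                                                ≡⟨ cong (_- x v) xu≡xv ⟩
        x v - x v                                                ≡⟨ -‿inverseʳ (x v) ⟩
        0#                                                       ∎
        where open ≡-Reasoning
      differences-vanish : (y u - y v ≡ 0#) × (z u - z v ≡ 0#)
      differences-vanish = combination≡0⇒≡0 0<s s<1 (x≤y⇒0≤y-x (proj₂ O-y u v u≼v)) (x≤y⇒0≤y-x (proj₂ O-z u v u≼v))
                                            combination-of-differences≡0
  split-level-pair O-y O-z 0<s s<1 x≡ (inj₂ v≼u) xu≡xv =
    Data.Product.map sym sym (split-level-pair O-y O-z 0<s s<1 x≡ (inj₁ v≼u) (sym xu≡xv))

module SignConditionNecessity (R : RealField) {d : ℕ} (_≼_ : Rel (Fin d) 0ℓ) (po : IsPartialOrder _≡_ _≼_) where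
  open OrderedField R
  open PosetStuff _≼_
  open Comparability R _≼_
  open OrderPolytopeBasics R _≼_ po

  -- The point x of the segment [ρ I, ρ J] where h vanishes.  Its decompositions
  -- inside O ∩ H⁺ are forced to be 1 on I, 0 off J and, J ∖ I being connected,
  -- constant on J ∖ I, where the constant is then pinned down by h = 0.
  module Crossing (c : Point d) {I J : Subset d} (I-ideal : IsIdeal I) (J-ideal : IsIdeal J)
                  (I⊆J : I ⊆ J) (connected : Connected (symDiff I J))
                  (hI<0 : lin c (ρ I) < 0#) (0<hJ : 0# < lin c (ρ J)) where
    a b D : Carrier
    a = lin c (ρ I)
    b = lin c (ρ J)
    D = b - a

    0<D : 0# < D
    0<D = x<y⇒0<y-x (<-trans hI<0 0<hJ)

    t : Carrier
    t = proj₁ (root-on-segment c (ρ J) (ρ I) 0<hJ hI<0)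

    0<t : 0# < t
    0<t = proj₁ (proj₂ (root-on-segment c (ρ J) (ρ I) 0<hJ hI<0))

    t<1 : t < 1#
    t<1 = proj₁ (proj₂ (proj₂ (root-on-segment c (ρ J) (ρ I) 0<hJ hI<0)))

    x : Point d
    x k = t * ρ I k + (1# - t) * ρ J k

    hx≡0 : lin c x ≡ 0#
    hx≡0 = proj₂ (proj₂ (proj₂ (root-on-segment c (ρ J) (ρ I) 0<hJ hI<0)))

    x-∈I : ∀ {k} → k ∈ I → x k ≡ 1#
    x-∈I {k} k∈I = trans (cong₂ (λ r r′ → t * r + (1# - t) * r′) (ρ-∈ k∈I) (ρ-∈ (I⊆J k∈I)))
                         (solve 1 (λ t → t :* :1 :+ (:1 :- t) :* :1 := :1) refl t)

    x-∉J : ∀ {k} → k ∉ J → x k ≡ 0#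
    x-∉J {k} k∉J = trans (cong₂ (λ r r′ → t * r + (1# - t) * r′) (ρ-∉ (k∉J ∘ I⊆J)) (ρ-∉ k∉J))
                         (solve 1 (λ t → t :* :0 :+ (:1 :- t) :* :0 := :0) refl t)

    x-J∖I : ∀ {k} → k ∈ J → k ∉ I → x k ≡ 1# - t
    x-J∖I {k} k∈J k∉I = trans (cong₂ (λ r r′ → t * r + (1# - t) * r′) (ρ-∉ k∉I) (ρ-∈ k∈J))
                              (solve 1 (λ t → t :* :0 :+ (:1 :- t) :* :1 := :1 :- t) refl t)

    ∈symDiff⇒∈J∖I : ∀ {k} → k ∈ symDiff I J → k ∈ J × k ∉ I
    ∈symDiff⇒∈J∖I k∈ with ∈-symDiff⁻ I J k∈
    ... | inj₁ (k∈I , k∉J) = ⊥-elim (k∉J (I⊆J k∈I))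
    ... | inj₂ k∈J∖I       = k∈J∖I

    lin-layers : ∀ (w : Point d) v → (∀ {k} → k ∈ I → w k ≡ 1#) → (∀ {k} → k ∉ J → w k ≡ 0#) →
                 (∀ {k} → k ∈ J → k ∉ I → w k ≡ v) → lin c w ≡ a + v * D
    lin-layers w v w-I w-J w-J∖I = begin
      lin c w                                         ≡⟨ lin-cong c layers ⟩
      lin c (λ k → 1# * ρ I k + v * (ρ J k - ρ I k))  ≡⟨ lin-combination c 1# v (ρ I) (λ k → ρ J k - ρ I k) ⟩
      1# * a + v * lin c (λ k → ρ J k - ρ I k)        ≡⟨ cong₂ (λ p q → p + v * q) (*-identityˡ a) lin-difference ⟩
      a + v * D                                       ∎
      where
        open ≡-Reasoning
        layers : ∀ k → w k ≡ 1# * ρ I k + v * (ρ J k - ρ I k)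
        layers k with k ∈? I | k ∈? J
        ... | yes k∈I | _       = trans (w-I k∈I) (trans (solve 1 (λ v → :1 := :1 :* :1 :+ v :* (:1 :- :1)) refl v)
                                    (cong₂ (λ r r′ → 1# * r + v * (r′ - r)) (sym (ρ-∈ k∈I)) (sym (ρ-∈ (I⊆J k∈I)))))
        ... | no k∉I  | yes k∈J = trans (w-J∖I k∈J k∉I) (trans (solve 1 (λ v → v := :1 :* :0 :+ v :* (:1 :- :0)) refl v)
                                    (cong₂ (λ r r′ → 1# * r + v * (r′ - r)) (sym (ρ-∉ k∉I)) (sym (ρ-∈ k∈J))))
        ... | no k∉I  | no k∉J  = trans (w-J k∉J) (trans (solve 1 (λ v → :0 := :1 :* :0 :+ v :* (:0 :- :0)) refl v)
                                    (cong₂ (λ r r′ → 1# * r + v * (r′ - r)) (sym (ρ-∉ k∉I)) (sym (ρ-∉ k∉J))))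
        lin-difference : lin c (λ k → ρ J k - ρ I k) ≡ D
        lin-difference = trans (lin-cong c (λ k → solve 2 (λ p q → p :- q := :1 :* p :+ (:- :1) :* q) refl (ρ J k) (ρ I k)))
          (trans (lin-combination c 1# (- 1#) (ρ J) (ρ I)) (solve 2 (λ b a → :1 :* b :+ (:- :1) :* a := b :- a) refl b a))

    module Decomposition {y z : Point d} {s : Carrier} (y∈H⁺ : UpperHalf c y) (z∈H⁺ : UpperHalf c z)
                         (0<s : 0# < s) (s<1 : s < 1#) (x≡ : ∀ k → x k ≡ s * y k + (1# - s) * z k) where
      O-y : O y
      O-y = proj₁ y∈H⁺

      O-z : O z
      O-z = proj₁ z∈H⁺

      hy≡0×hz≡0 : (lin c y ≡ 0#) × (lin c z ≡ 0#)
      hy≡0×hz≡0 = combination≡0⇒≡0 0<s s<1 (proj₂ y∈H⁺) (proj₂ z∈H⁺)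
        (trans (sym (trans (lin-cong c x≡) (lin-combination c s (1# - s) y z))) hx≡0)

      on-I : ∀ {k} → k ∈ I → (y k ≡ 1#) × (z k ≡ 1#)
      on-I {k} k∈I = combination≡1⇒≡1 0<s s<1 (proj₂ (proj₁ O-y k)) (proj₂ (proj₁ O-z k)) (trans (sym (x≡ k)) (x-∈I k∈I))

      off-J : ∀ {k} → k ∉ J → (y k ≡ 0#) × (z k ≡ 0#)
      off-J {k} k∉J = combination≡0⇒≡0 0<s s<1 (proj₁ (proj₁ O-y k)) (proj₁ (proj₁ O-z k)) (trans (sym (x≡ k)) (x-∉J k∉J))

      level : ∀ {u v} → u ∈ symDiff I J → v ∈ symDiff I J → Comparable u v → (y u , z u) ≡ (y v , z v)
      level {u} {v} u∈ v∈ u~v = cong₂ _,_ (proj₁ split) (proj₂ split)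
        where
          u∈J∖I : u ∈ J × u ∉ I
          u∈J∖I = ∈symDiff⇒∈J∖I u∈
          v∈J∖I : v ∈ J × v ∉ I
          v∈J∖I = ∈symDiff⇒∈J∖I v∈
          split : (y u ≡ y v) × (z u ≡ z v)
          split = split-level-pair O-y O-z 0<s s<1 x≡ u~v
                    (trans (x-J∖I (proj₁ u∈J∖I) (proj₂ u∈J∖I)) (sym (x-J∖I (proj₁ v∈J∖I) (proj₂ v∈J∖I))))

      on-J∖I : ∀ {k₀ k} → k₀ ∈ symDiff I J → k ∈ symDiff I J → (y k , z k) ≡ (y k₀ , z k₀)
      on-J∖I k₀∈ k∈ = constant-along-paths (λ k → y k , z k) level k₀∈ (connected _ _ k₀∈ k∈)

      h≡a+value*D : ∀ (w : Point d) {k₀} → k₀ ∈ symDiff I J → (∀ {k} → k ∈ symDiff I J → w k ≡ w k₀) →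
                    (∀ {k} → k ∈ I → w k ≡ 1#) → (∀ {k} → k ∉ J → w k ≡ 0#) → lin c w ≡ a + w k₀ * D
      h≡a+value*D w {k₀} k₀∈ w-const w-I w-J =
        lin-layers w (w k₀) w-I w-J (λ k∈J k∉I → w-const (∈-symDiff⁺ I J (inj₂ (k∈J , k∉I))))

      y≡z-on-J∖I : ∀ {k} → k ∈ symDiff I J → y k ≡ z k
      y≡z-on-J∖I {k} k∈ = +*-cancelˡ 0<D (trans (sym hy≡a+ykD) (trans (proj₁ hy≡0×hz≡0) (trans (sym (proj₂ hy≡0×hz≡0)) hz≡a+zkD)))
        where
          hy≡a+ykD : lin c y ≡ a + y k * D
          hy≡a+ykD = h≡a+value*D y k∈ (λ k′∈ → cong proj₁ (on-J∖I k∈ k′∈)) (proj₁ ∘ on-I) (proj₁ ∘ off-J)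
          hz≡a+zkD : lin c z ≡ a + z k * D
          hz≡a+zkD = h≡a+value*D z k∈ (λ k′∈ → cong proj₂ (on-J∖I k∈ k′∈)) (proj₂ ∘ on-I) (proj₂ ∘ off-J)

      y≡z : ∀ k → y k ≡ z k
      y≡z k with k ∈? I | k ∈? J
      ... | yes k∈I | _       = trans (proj₁ (on-I k∈I)) (sym (proj₂ (on-I k∈I)))
      ... | no  k∉I | no k∉J  = trans (proj₁ (off-J k∉J)) (sym (proj₂ (off-J k∉J)))
      ... | no  k∉I | yes k∈J = y≡z-on-J∖I (∈-symDiff⁺ I J (inj₂ (k∈J , k∉I)))

    x-vertex : IsVertex (UpperHalf c) x
    x-vertex = (O-convex ρI∈O ρJ∈O (inj₁ 0<t) (inj₁ t<1) , inj₂ (sym hx≡0)) ,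
               λ y z s y∈H⁺ z∈H⁺ 0<s s<1 x≡ → Decomposition.y≡z y∈H⁺ z∈H⁺ 0<s s<1 x≡
      where
        ρI∈O : O (ρ I)
        ρI∈O = ideal⇒ρ∈O I-ideal
        ρJ∈O : O (ρ J)
        ρJ∈O = ideal⇒ρ∈O J-ideal

    x-not-vertex : ¬ IsVertex O x
    x-not-vertex (_ , extreme) = <⇒≢ (<-trans hI<0 0<hJ)
      (lin-cong c (extreme (ρ I) (ρ J) t (ideal⇒ρ∈O I-ideal) (ideal⇒ρ∈O J-ideal) 0<t t<1 (λ _ → refl)))

  no-crossing : ∀ c → PreservesUpperVertices c → ∀ {I J} → IsIdeal I → IsIdeal J → I ⊆ J →
                Connected (symDiff I J) → lin c (ρ I) < 0# → ¬ 0# < lin c (ρ J)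
  no-crossing c preserves I-ideal J-ideal I⊆J connected hI<0 0<hJ = x-not-vertex (preserves x x-vertex)
    where open Crossing c I-ideal J-ideal I⊆J connected hI<0 0<hJ

  preserves⇒sign-condition : ∀ c → PreservesUpperVertices c → PreservesUpperVertices (negate c) → SignCondition c
  preserves⇒sign-condition c preserves⁺ preserves⁻ I J I-ideal J-ideal connected = ≮⇒≥ λ hIhJ<0 →
    refute (connected-symDiff⇒nested I-ideal J-ideal connected) (neg*pos⊎pos*neg hIhJ<0)
    where
      connected′ : Connected (symDiff J I)
      connected′ = connected-symDiff-comm I J connected
      negate-neg : ∀ {y} → 0# < lin c y → lin (negate c) y < 0#
      negate-neg {y} 0<hy = subst (_< 0#) (sym (lin-negateˡ c y)) (0<x⇒-x<0 0<hy)
      negate-pos : ∀ {y} → lin c y < 0# → 0# < lin (negate c) y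
      negate-pos {y} hy<0 = subst (0# <_) (sym (lin-negateˡ c y)) (x<0⇒0<-x hy<0)
      refute : I ⊆ J ⊎ J ⊆ I → (lin c (ρ I) < 0# × 0# < lin c (ρ J)) ⊎ (0# < lin c (ρ I) × lin c (ρ J) < 0#) → ⊥
      refute (inj₁ I⊆J) (inj₁ (hI<0 , 0<hJ)) = no-crossing c preserves⁺ I-ideal J-ideal I⊆J connected hI<0 0<hJ
      refute (inj₁ I⊆J) (inj₂ (0<hI , hJ<0)) =
        no-crossing (negate c) preserves⁻ I-ideal J-ideal I⊆J connected (negate-neg 0<hI) (negate-pos hJ<0)
      refute (inj₂ J⊆I) (inj₁ (hI<0 , 0<hJ)) =
        no-crossing (negate c) preserves⁻ J-ideal I-ideal J⊆I connected′ (negate-neg 0<hJ) (negate-pos hI<0)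
      refute (inj₂ J⊆I) (inj₂ (0<hI , hJ<0)) = no-crossing c preserves⁺ J-ideal I-ideal J⊆I connected′ hJ<0 0<hI


module RelativeInteriorRoot (R : RealField) {d : ℕ} (_≼_ : Rel (Fin d) 0ℓ) (po : IsPartialOrder _≡_ _≼_) where
  open OrderedField R
  open PosetStuff _≼_
  open OrderPolytopeBasics R _≼_ po

  HasMargin : Carrier → Point d → Set
  HasMargin u x = (0# < u) × (∀ k → u ≤ x k) × (∀ k → u ≤ 1# - x k) × (∀ j k → j ≼ k → ¬ j ≡ k → u ≤ x j - x k)

  margin⇒O : ∀ {u} {x : Point d} → HasMargin u x → O x
  margin⇒O {u} {x} (0<u , u≤x , u≤1-x , u≤gap) = (λ k → lower k , upper k) , antitone
    where
      lower : ∀ k → 0# ≤ x k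
      lower k = ≤-trans (inj₁ 0<u) (u≤x k)
      upper : ∀ k → x k ≤ 1#
      upper k = 0≤y-x⇒x≤y (≤-trans (inj₁ 0<u) (u≤1-x k))
      antitone : ∀ j k → j ≼ k → x k ≤ x j
      antitone j k j≼k with j Fin.≟ k
      ... | yes refl = ≤-refl
      ... | no  j≢k  = 0≤y-x⇒x≤y (≤-trans (inj₁ 0<u) (u≤gap j k j≼k j≢k))

  -- Prolonging by the margin u itself keeps every inequality.
  margin⇒relint : ∀ {u} {x : Point d} → HasMargin u x → InRelInt O x
  margin⇒relint {u} {x} margin@(0<u , u≤x , u≤1-x , u≤gap) = x∈O , λ y y∈O → u , 0<u , bounds y y∈O , antitone y y∈O
    where
      x∈O : O x
      x∈O = margin⇒O margin
      0≤u : 0# ≤ u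
      0≤u = inj₁ 0<u
      bounds : ∀ y → O y → ∀ k → (0# ≤ x k + u * (x k - y k)) × (x k + u * (x k - y k) ≤ 1#)
      bounds y (y-bounded , _) k =
        subst (0# ≤_) (solve 3 (λ x u y → (x :- u) :+ u :* x :+ u :* (:1 :- y) := x :+ u :* (x :- y)) refl (x k) u (y k))
          (+-nonNeg (+-nonNeg (x≤y⇒0≤y-x (u≤x k)) (*-nonNeg 0≤u (proj₁ (proj₁ x∈O k))))
                    (*-nonNeg 0≤u (x≤y⇒0≤y-x (proj₂ (y-bounded k))))) ,
        0≤y-x⇒x≤y (subst (0# ≤_) (solve 3 (λ x u y → (:1 :- x :- u) :+ u :* (:1 :- x) :+ u :* y
                                                      := :1 :- (x :+ u :* (x :- y))) refl (x k) u (y k))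
          (+-nonNeg (+-nonNeg (x≤y⇒0≤y-x (u≤1-x k)) (*-nonNeg 0≤u (x≤y⇒0≤y-x (proj₂ (proj₁ x∈O k)))))
                    (*-nonNeg 0≤u (proj₁ (y-bounded k)))))
      antitone : ∀ y → O y → ∀ j k → j ≼ k → x k + u * (x k - y k) ≤ x j + u * (x j - y j)
      antitone y (y-bounded , _) j k j≼k with j Fin.≟ k
      ... | yes refl = ≤-refl
      ... | no  j≢k  = 0≤y-x⇒x≤y (subst (0# ≤_)
            (solve 5 (λ xj xk u yj yk → (xj :- xk :- u) :+ u :* (xj :- xk) :+ u :* ((:1 :- yj) :+ yk)
                                        := (xj :+ u :* (xj :- yj)) :- (xk :+ u :* (xk :- yk)))
                     refl (x j) (x k) u (y j) (y k))
            (+-nonNeg (+-nonNeg (x≤y⇒0≤y-x (u≤gap j k j≼k j≢k)) (*-nonNeg 0≤u (x≤y⇒0≤y-x (proj₂ x∈O j k j≼k))))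
                      (*-nonNeg 0≤u (+-nonNeg (x≤y⇒0≤y-x (proj₂ (y-bounded j))) (proj₁ (y-bounded k))))))

  margin-combination : ∀ {u s} {p q : Point d} → HasMargin u p → O q → 0# ≤ s → s < 1# →
                       HasMargin ((1# - s) * u) (λ k → s * q k + (1# - s) * p k)
  margin-combination {u} {s} {p} {q} (0<u , u≤p , u≤1-p , u≤gap) (q-bounded , q-antitone) 0≤s s<1 =
    *-pos 0<1-s 0<u , lower , upper , gap
    where
      0<1-s : 0# < 1# - s
      0<1-s = x<y⇒0<y-x s<1
      0≤1-s : 0# ≤ 1# - s
      0≤1-s = inj₁ 0<1-s
      lower : ∀ k → (1# - s) * u ≤ s * q k + (1# - s) * p k
      lower k = 0≤y-x⇒x≤y (subst (0# ≤_)
        (solve 4 (λ s q p u → s :* q :+ (:1 :- s) :* (p :- u) := (s :* q :+ (:1 :- s) :* p) :- (:1 :- s) :* u)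
                 refl s (q k) (p k) u)
        (+-nonNeg (*-nonNeg 0≤s (proj₁ (q-bounded k))) (*-nonNeg 0≤1-s (x≤y⇒0≤y-x (u≤p k)))))
      upper : ∀ k → (1# - s) * u ≤ 1# - (s * q k + (1# - s) * p k)
      upper k = 0≤y-x⇒x≤y (subst (0# ≤_)
        (solve 4 (λ s q p u → s :* (:1 :- q) :+ (:1 :- s) :* ((:1 :- p) :- u)
                              := (:1 :- (s :* q :+ (:1 :- s) :* p)) :- (:1 :- s) :* u) refl s (q k) (p k) u)
        (+-nonNeg (*-nonNeg 0≤s (x≤y⇒0≤y-x (proj₂ (q-bounded k)))) (*-nonNeg 0≤1-s (x≤y⇒0≤y-x (u≤1-p k)))))
      gap : ∀ j k → j ≼ k → ¬ j ≡ k → (1# - s) * u ≤ (s * q j + (1# - s) * p j) - (s * q k + (1# - s) * p k)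
      gap j k j≼k j≢k = 0≤y-x⇒x≤y (subst (0# ≤_)
        (solve 6 (λ s qj qk pj pk u → s :* (qj :- qk) :+ (:1 :- s) :* ((pj :- pk) :- u)
                   := ((s :* qj :+ (:1 :- s) :* pj) :- (s :* qk :+ (:1 :- s) :* pk)) :- (:1 :- s) :* u)
                 refl s (q j) (q k) (p j) (p k) u)
        (+-nonNeg (*-nonNeg 0≤s (x≤y⇒0≤y-x (q-antitone j k j≼k))) (*-nonNeg 0≤1-s (x≤y⇒0≤y-x (u≤gap j k j≼k j≢k)))))

  -- height k = 1 + |{j | j ⋢ k}| strictly decreases along ≺, so height / (d + 2)
  -- is a point with margin 1 / (d + 2).
  notBelow : Fin d → Subset d
  notBelow k = DecidableSubset.subset (λ j → ¬? (j ⊑? k))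

  module notBelow (k : Fin d) = DecidableSubset (λ j → ¬? (j ⊑? k))

  height : Fin d → ℕ
  height k = ℕ.suc ∣ notBelow k ∣

  height≤d : ∀ k → height k ℕ.≤ d
  height≤d k = subst (ℕ.suc ∣ notBelow k ∣ ℕ.≤_) (∣⊤∣≡n d)
    (p⊂q⇒∣p∣<∣q∣ ((λ _ → ∈⊤) , k , ∈⊤ , λ k∈ → notBelow.∈-subset⁻ k k∈ ⊑-refl))

  height-decreasing : ∀ {j k} → j ≼ k → ¬ j ≡ k → height k ℕ.< height j
  height-decreasing {j} {k} j≼k j≢k = ℕ.s≤s (p⊂q⇒∣p∣<∣q∣ (notBelow-k⊆notBelow-j , k , k∈notBelow-j , k∉notBelow-k))
    where
      notBelow-k⊆notBelow-j : notBelow k ⊆ notBelow j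
      notBelow-k⊆notBelow-j i∈ = notBelow.∈-subset⁺ j λ i⊑j → notBelow.∈-subset⁻ k i∈ (⊑-trans i⊑j (≼⇒⊑ j≼k))
      k∈notBelow-j : k ∈ notBelow j
      k∈notBelow-j = notBelow.∈-subset⁺ j λ k⊑j → j≢k (⊑-antisym (≼⇒⊑ j≼k) k⊑j)
      k∉notBelow-k : k ∉ notBelow k
      k∉notBelow-k k∈ = notBelow.∈-subset⁻ k k∈ ⊑-refl

  0<d+2 : 0# < fromℕ (ℕ.suc (ℕ.suc d))
  0<d+2 = <-≤-trans 0<1 (subst₂ _≤_ (+-identityʳ 1#) (sym (fromℕ-suc (ℕ.suc d)))
                                    (+-monoʳ-≤ 1# (fromℕ-nonNeg (ℕ.suc d))))

  unit : Carrier
  unit = proj₁ (positive-inverse 0<d+2)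

  0<unit : 0# < unit
  0<unit = proj₁ (proj₂ (positive-inverse 0<d+2))

  [d+2]*unit≡1 : fromℕ (ℕ.suc (ℕ.suc d)) * unit ≡ 1#
  [d+2]*unit≡1 = proj₂ (proj₂ (positive-inverse 0<d+2))

  unit≤gap : ∀ {a b} → a ℕ.< b → unit ≤ fromℕ b * unit - fromℕ a * unit
  unit≤gap {a} {b} a<b = 0≤y-x⇒x≤y (subst (0# ≤_)
    (solve 3 (λ B A u → (B :- (:1 :+ A)) :* u := B :* u :- A :* u :- u) refl (fromℕ b) (fromℕ a) unit)
    (*-nonNeg (x≤y⇒0≤y-x (subst (_≤ fromℕ b) (fromℕ-suc a) (fromℕ-mono-≤ {ℕ.suc a} {b} a<b))) (inj₁ 0<unit)))

  interior : Point d
  interior k = fromℕ (height k) * unit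

  interior-margin : HasMargin unit interior
  interior-margin = 0<unit , lower , upper , gap
    where
      lower : ∀ k → unit ≤ interior k
      lower k = subst (_≤ interior k) (*-identityˡ unit) (*-monoʳ-≤-nonNeg (inj₁ 0<unit)
        (subst₂ _≤_ (+-identityʳ 1#) (sym (fromℕ-suc ∣ notBelow k ∣)) (+-monoʳ-≤ 1# (fromℕ-nonNeg ∣ notBelow k ∣))))
      upper : ∀ k → unit ≤ 1# - interior k
      upper k = subst (λ one → unit ≤ one - interior k) [d+2]*unit≡1
                      (unit≤gap {height k} {ℕ.suc (ℕ.suc d)} (ℕ.s≤s (ℕ.m≤n⇒m≤1+n (height≤d k))))
      gap : ∀ j k → j ≼ k → ¬ j ≡ k → unit ≤ interior j - interior k
      gap j k j≼k j≢k = unit≤gap {height k} {height j} (height-decreasing j≼k j≢k)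

  root-towards : ∀ c {q} → O q → 0# < lin c interior → lin c q < 0# → ∃ λ x → (lin c x ≡ 0#) × InRelInt O x
  root-towards c {q} q∈O 0<hp hq<0 =
    (λ k → s * q k + (1# - s) * interior k) , root , margin⇒relint (margin-combination interior-margin q∈O (inj₁ 0<s) s<1)
    where
      s : Carrier
      s = proj₁ (root-on-segment c interior q 0<hp hq<0)
      0<s : 0# < s
      0<s = proj₁ (proj₂ (root-on-segment c interior q 0<hp hq<0))
      s<1 : s < 1#
      s<1 = proj₁ (proj₂ (proj₂ (root-on-segment c interior q 0<hp hq<0)))
      root : lin c (λ k → s * q k + (1# - s) * interior k) ≡ 0#
      root = proj₂ (proj₂ (proj₂ (root-on-segment c interior q 0<hp hq<0)))

  relint-root : ∀ c → (∃ λ I → IsIdeal I × (0# < lin c (ρ I))) → (∃ λ J → IsIdeal J × (lin c (ρ J) < 0#)) →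
                ∃ λ x → (lin c x ≡ 0#) × InRelInt O x
  relint-root c (I , I-ideal , 0<hI) (J , J-ideal , hJ<0) with compare (lin c interior) 0#
  ... | tri≈ _ hp≡0 _ = interior , hp≡0 , margin⇒relint interior-margin
  ... | tri> _ _ 0<hp = root-towards c (ideal⇒ρ∈O J-ideal) 0<hp hJ<0
  ... | tri< hp<0 _ _ = proj₁ root , negate-root⇒root c (proj₁ (proj₂ root)) , proj₂ (proj₂ root)
    where
      root : ∃ λ x → (lin (negate c) x ≡ 0#) × InRelInt O x
      root = root-towards (negate c) (ideal⇒ρ∈O I-ideal)
               (subst (0# <_) (sym (lin-negateˡ c interior)) (x<0⇒0<-x hp<0))
               (subst (_< 0#) (sym (lin-negateˡ c (ρ I))) (0<x⇒-x<0 0<hI))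

module SignConditionSufficiency (R : RealField) {d : ℕ} (_≼_ : Rel (Fin d) 0ℓ) (po : IsPartialOrder _≡_ _≼_) where
  open OrderedField R
  open PosetStuff _≼_
  open Comparability R _≼_
  open OrderPolytopeBasics R _≼_ po

  Fractional : Point d → Fin d → Set
  Fractional x k = (0# < x k) × (x k < 1#)

  fractional? : ∀ x k → Dec (Fractional x k)
  fractional? x k = (0# <? x k) ×-dec (x k <? 1#)

  -- Small moves along w stay in O: coordinates that w moves have slack, and
  -- comparable coordinates that w moves apart were already strictly ordered.
  module Perturbation {x w : Point d} (x∈O : O x) (w-fractional : ∀ k → ¬ w k ≡ 0# → Fractional x k)
                      (w-level : ∀ j k → j ≼ k → x j ≡ x k → w j ≡ w k) where
    shift : Carrier → Point d
    shift δ k = x k + δ * w k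

    unmoved : ∀ δ {k} → w k ≡ 0# → shift δ k ≡ x k
    unmoved δ {k} w≡0 = trans (cong (λ r → x k + δ * r) w≡0) (trans (cong (x k +_) (zeroʳ δ)) (+-identityʳ (x k)))

    eventually-bounded : ∀ k → Eventually (λ δ → (0# ≤ shift δ k) × (shift δ k ≤ 1#))
    eventually-bounded k with w k ≟ 0#
    ... | yes w≡0 = always⇒eventually λ δ _ → subst (λ r → (0# ≤ r) × (r ≤ 1#)) (sym (unmoved δ w≡0)) (proj₁ x∈O k)
    ... | no  w≢0 = eventually-map (λ _ _ (lower , upper) → δ*-w≤x⇒0≤x+δ*w lower , δ*w≤1-x⇒x+δ*w≤1 upper)
                      (eventually-× (eventually-*-≤ (- w k) (proj₁ (w-fractional k w≢0)))
                                    (eventually-*-≤ (w k) (x<y⇒0<y-x (proj₂ (w-fractional k w≢0)))))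

    eventually-antitone : ∀ j k → Eventually (λ δ → j ≼ k → shift δ k ≤ shift δ j)
    eventually-antitone j k with compare (x j) (x k)
    ... | tri≈ _ xj≡xk _ = always⇒eventually λ δ _ j≼k →
                             inj₂ (cong₂ (λ a r → a + δ * r) (sym xj≡xk) (sym (w-level j k j≼k xj≡xk)))
    ... | tri< xj<xk _ _ = always⇒eventually λ _ _ j≼k → ⊥-elim (<⇒≱ xj<xk (proj₂ x∈O j k j≼k))
    ... | tri> _ _ xk<xj = eventually-map (λ _ _ bound _ → δ*[v-w]≤y-x⇒x+δ*v≤y+δ*w bound)
                             (eventually-*-≤ (w k - w j) (x<y⇒0<y-x xk<xj))

    eventually-in-O : Eventually (λ δ → O (shift δ))
    eventually-in-O = eventually-map (λ _ _ (bounded , antitone) → bounded , antitone)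
      (eventually-× (eventually-∀ {P = λ k δ → (0# ≤ shift δ k) × (shift δ k ≤ 1#)} eventually-bounded)
                    (eventually-∀ {P = λ j δ → ∀ k → j ≼ k → shift δ k ≤ shift δ j}
                                  λ j → eventually-∀ {P = λ k δ → j ≼ k → shift δ k ≤ shift δ j} (eventually-antitone j)))

  -- x is the midpoint of x ± δw, and both stay in O ∩ H⁺ when h(w) = 0.
  vertex-rigid : ∀ c {x} → IsVertex (UpperHalf c) x → ∀ {w} → (∀ k → ¬ w k ≡ 0# → Fractional x k) →
                 (∀ j k → j ≼ k → x j ≡ x k → w j ≡ w k) → lin c w ≡ 0# → ∀ k → w k ≡ 0#
  vertex-rigid c {x} ((x∈O , 0≤hx) , extreme) {w} w-fractional w-level hw≡0 k =
    pos*x≡0⇒x≡0 0<δ (x+e≡x-e⇒e≡0 (trans y≡z (cong (x k +_) (sym (-‿distribʳ-* δ (w k))))))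
    where
      module + = Perturbation x∈O w-fractional w-level
      module - = Perturbation {w = negate w} x∈O (λ k -w≢0 → w-fractional k (-w≢0 ∘ λ w≡0 → trans (cong -_ w≡0) -0#≈0#))
                                             (λ j k j≼k xj≡xk → cong -_ (w-level j k j≼k xj≡xk))
      picked : ∃ λ δ → (0# < δ) × (O (+.shift δ) × O (-.shift δ))
      picked = eventually⇒witness (eventually-× +.eventually-in-O -.eventually-in-O)
      δ : Carrier
      δ = proj₁ picked
      0<δ : 0# < δ
      0<δ = proj₁ (proj₂ picked)
      h-unchanged : ∀ v → lin c v ≡ 0# → lin c (λ k → x k + δ * v k) ≡ lin c x
      h-unchanged v hv≡0 = trans (lin-shift c x v δ) (trans (cong (λ r → lin c x + δ * r) hv≡0)
                             (trans (cong (lin c x +_) (zeroʳ δ)) (+-identityʳ (lin c x))))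
      y∈H⁺ : UpperHalf c (+.shift δ)
      y∈H⁺ = proj₁ (proj₂ (proj₂ picked)) , subst (0# ≤_) (sym (h-unchanged w hw≡0)) 0≤hx
      z∈H⁺ : UpperHalf c (-.shift δ)
      z∈H⁺ = proj₂ (proj₂ (proj₂ picked)) ,
             subst (0# ≤_) (sym (h-unchanged (negate w) (trans (lin-negateʳ c w) (trans (cong -_ hw≡0) -0#≈0#)))) 0≤hx
      midpoint : ∀ k → x k ≡ ½ * +.shift δ k + (1# - ½) * -.shift δ k
      midpoint k = sym (trans (cong (λ r → ½ * +.shift δ k + (1# - ½) * (x k + r)) (sym (-‿distribʳ-* δ (w k))))
                              (½-midpoint (x k) (δ * w k)))
      y≡z : x k + δ * w k ≡ x k + δ * - w k
      y≡z = extreme (+.shift δ) (-.shift δ) ½ y∈H⁺ z∈H⁺ 0<½ ½<1 midpoint k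

  -- Paths are
  -- not decidable, so membership is ¬¬-reachability (decidable by weak excluded
  -- middle) and connectedness only holds up to double negation.
  module Component (x : Point d) (i : Fin d) where
    module L = DecidableSubset (λ k → x k ≟ x i)
    module C = DecidableSubset (λ k → weak-excluded-middle (¬ Path L.subset i k))

    C : Subset d
    C = C.subset

    i∈C : i ∈ C
    i∈C = C.∈-subset⁺ λ ¬path → ¬path here

    C-level : ∀ {k} → k ∈ C → x k ≡ x i
    C-level {k} k∈C = decidable-stable (x k ≟ x i) λ xk≢xi →
      C.∈-subset⁻ k∈C λ path → xk≢xi (L.∈-subset⁻ (path-end∈ path (L.∈-subset⁺ refl)))

    C-closed : ∀ {j k} → k ∈ C → Comparable k j → x j ≡ x k → j ∈ C
    C-closed k∈C k~j xj≡xk = C.∈-subset⁺ λ ¬path →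
      C.∈-subset⁻ k∈C λ path → ¬path (step path (L.∈-subset⁺ (trans xj≡xk (C-level k∈C))) k~j)

    lift : ∀ {k} → Path L.subset i k → Path C i k
    lift here               = here
    lift (step path k∈L j~k) = step (lift path) (C.∈-subset⁺ λ ¬path → ¬path (step path k∈L j~k)) j~k

    ¬¬connected : ¬ ¬ Connected C
    ¬¬connected = ¬¬-shift λ a → ¬¬-shift λ b → joined a b
      where
        joined : ∀ a b → ¬ ¬ (a ∈ C → b ∈ C → Path C a b)
        joined a b ¬joined with a ∈? C | b ∈? C
        ... | no a∉C | _       = ¬joined λ a∈C → ⊥-elim (a∉C a∈C)
        ... | yes _  | no b∉C  = ¬joined λ _ b∈C → ⊥-elim (b∉C b∈C)
        ... | yes a∈C | yes b∈C = C.∈-subset⁻ a∈C λ path-a → C.∈-subset⁻ b∈C λ path-b →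
                                    ¬joined λ _ _ → reverse (lift path-a) i∈C ++ᵖ lift path-b

    ρC-level : ∀ j k → j ≼ k → x j ≡ x k → ρ C j ≡ ρ C k
    ρC-level j k j≼k xj≡xk with j ∈? C | k ∈? C
    ... | yes j∈C | _       = trans (ρ-∈ j∈C) (sym (ρ-∈ (C-closed j∈C (inj₁ j≼k) (sym xj≡xk))))
    ... | no  j∉C | yes k∈C = ⊥-elim (j∉C (C-closed k∈C (inj₂ j≼k) xj≡xk))
    ... | no  j∉C | no  k∉C = trans (ρ-∉ j∉C) (sym (ρ-∉ k∉C))

  module FractionalCoordinates (c : Point d) (sign-condition : SignCondition c) {x : Point d}
                               (x-vertex : IsVertex (UpperHalf c) x) where
    x∈O : O x
    x∈O = proj₁ (proj₁ x-vertex)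

    0≤hx : 0# ≤ lin c x
    0≤hx = proj₂ (proj₁ x-vertex)

    -- Two level-respecting fractional layers A, B: the combination
    -- h(B) ρ A − h(A) ρ B (or ρ A, when h(A) = 0) is a perturbation direction.
    module TwoLayers {A B : Subset d} (A-fractional : ∀ {k} → k ∈ A → Fractional x k)
                     (B-fractional : ∀ {k} → k ∈ B → Fractional x k)
                     (A-level : ∀ j k → j ≼ k → x j ≡ x k → ρ A j ≡ ρ A k)
                     (B-level : ∀ j k → j ≼ k → x j ≡ x k → ρ B j ≡ ρ B k) where
      combination-vanishes : ∀ α β → α * lin c (ρ A) + β * lin c (ρ B) ≡ 0# → ∀ k → α * ρ A k + β * ρ B k ≡ 0#
      combination-vanishes α β hw≡0 = vertex-rigid c x-vertex w-fractional w-level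
                                        (trans (lin-combination c α β (ρ A) (ρ B)) hw≡0)
        where
          w-fractional : ∀ k → ¬ α * ρ A k + β * ρ B k ≡ 0# → Fractional x k
          w-fractional k w≢0 with k ∈? A | k ∈? B
          ... | yes k∈A | _       = A-fractional k∈A
          ... | no  _   | yes k∈B = B-fractional k∈B
          ... | no  k∉A | no  k∉B = ⊥-elim (w≢0 (trans (cong₂ (λ r r′ → α * r + β * r′) (ρ-∉ k∉A) (ρ-∉ k∉B))
                                                       (solve 2 (λ α β → α :* :0 :+ β :* :0 := :0) refl α β)))
          w-level : ∀ j k → j ≼ k → x j ≡ x k → α * ρ A j + β * ρ B j ≡ α * ρ A k + β * ρ B k
          w-level j k j≼k xj≡xk = cong₂ (λ r r′ → α * r + β * r′) (A-level j k j≼k xj≡xk) (B-level j k j≼k xj≡xk)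

      separated⇒⊥ : ∀ {a b} → a ∈ A → b ∈ B → b ∉ A → ⊥
      separated⇒⊥ {a} {b} a∈A b∈B b∉A with lin c (ρ A) ≟ 0#
      ... | yes hA≡0 = 0≢1 (sym (trans (solve 1 (λ r → :1 := :1 :* :1 :+ :0 :* r) refl (ρ B a))
                                  (trans (cong (λ r → 1# * r + 0# * ρ B a) (sym (ρ-∈ a∈A)))
                                    (combination-vanishes 1# 0# (trans (cong (λ h → 1# * h + 0# * lin c (ρ B)) hA≡0)
                                       (solve 1 (λ h → :1 :* :0 :+ :0 :* h := :0) refl (lin c (ρ B)))) a))))
      ... | no  hA≢0 = hA≢0 (trans (solve 2 (λ hA hB → hA := :- (hB :* :0 :+ (:- hA) :* :1)) refl (lin c (ρ A)) (lin c (ρ B)))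
                         (trans (cong₂ (λ r r′ → - (lin c (ρ B) * r + (- lin c (ρ A)) * r′)) (sym (ρ-∉ b∉A)) (sym (ρ-∈ b∈B)))
                           (trans (cong -_ (combination-vanishes (lin c (ρ B)) (- lin c (ρ A))
                                    (solve 2 (λ hA hB → hB :* hA :+ (:- hA) :* hB := :0) refl (lin c (ρ A)) (lin c (ρ B))) b))
                             -0#≈0#)))

    module C = Component x

    component-fractional : ∀ {i k} → Fractional x i → k ∈ C.C i → Fractional x k
    component-fractional {i} frac-i k∈C = subst (λ r → (0# < r) × (r < 1#)) (sym (C.C-level i k∈C)) frac-i

    two-components : ∀ {i j} → Fractional x i → Fractional x j → j ∉ C.C i → ⊥
    two-components {i} {j} frac-i frac-j j∉Ci =
      TwoLayers.separated⇒⊥ (component-fractional frac-i) (component-fractional frac-j)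
                              (C.ρC-level i) (C.ρC-level j) (C.i∈C i) (C.i∈C j) j∉Ci

    -- With a single fractional component, x = v ρ B + (1 − v) ρ A for the ideals
    -- A = {x = 1} and B = {x > 0}, whose symmetric difference is that component.
    module OneComponent {i : Fin d} (frac-i : Fractional x i) (all-in-C : ∀ k → Fractional x k → k ∈ C.C i) where
      v : Carrier
      v = x i

      module A = DecidableSubset (λ k → x k ≟ 1#)
      module B = DecidableSubset (λ k → 0# <? x k)

      A B : Subset d
      A = A.subset
      B = B.subset

      A-ideal : IsIdeal A
      A-ideal k j k∈A j≼k =
        A.∈-subset⁺ (≤-antisym (proj₂ (proj₁ x∈O j)) (subst (_≤ x j) (A.∈-subset⁻ k∈A) (proj₂ x∈O j k j≼k)))

      B-ideal : IsIdeal B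
      B-ideal k j k∈B j≼k = B.∈-subset⁺ (<-≤-trans (B.∈-subset⁻ k∈B) (proj₂ x∈O j k j≼k))

      A⊆B : ∀ {k} → k ∈ A → k ∈ B
      A⊆B k∈A = B.∈-subset⁺ (subst (0# <_) (sym (A.∈-subset⁻ k∈A)) 0<1)

      B∖A-fractional : ∀ {k} → k ∈ B → k ∉ A → Fractional x k
      B∖A-fractional k∈B k∉A = B.∈-subset⁻ k∈B , ≤∧≢⇒< (proj₂ (proj₁ x∈O _)) (k∉A ∘ A.∈-subset⁺)

      symDiff⊆C : ∀ {k} → k ∈ symDiff A B → k ∈ C.C i
      symDiff⊆C {k} k∈ with ∈-symDiff⁻ A B k∈
      ... | inj₁ (k∈A , k∉B) = ⊥-elim (k∉B (A⊆B k∈A))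
      ... | inj₂ (k∈B , k∉A) = all-in-C k (B∖A-fractional k∈B k∉A)

      C⊆symDiff : ∀ {k} → k ∈ C.C i → k ∈ symDiff A B
      C⊆symDiff k∈C with component-fractional frac-i k∈C
      ... | 0<xk , xk<1 = ∈-symDiff⁺ A B (inj₂ (B.∈-subset⁺ 0<xk , λ k∈A → <⇒≢ xk<1 (A.∈-subset⁻ k∈A)))

      0≤hA*hB : 0# ≤ lin c (ρ A) * lin c (ρ B)
      0≤hA*hB = ≤-stable (¬¬-map (sign-condition A B A-ideal B-ideal) λ ¬connected → C.¬¬connected i λ connected →
        ¬connected λ a b a∈ b∈ → path-⊆ C⊆symDiff (connected a b (symDiff⊆C a∈) (symDiff⊆C b∈)))

      x≡vB+[1-v]A : ∀ k → x k ≡ v * ρ B k + (1# - v) * ρ A k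
      x≡vB+[1-v]A k with k ∈? A | k ∈? B
      ... | yes k∈A | _       = trans (A.∈-subset⁻ k∈A) (trans (solve 1 (λ v → :1 := v :* :1 :+ (:1 :- v) :* :1) refl v)
                                  (sym (cong₂ (λ r r′ → v * r + (1# - v) * r′) (ρ-∈ (A⊆B k∈A)) (ρ-∈ k∈A))))
      ... | no  k∉A | yes k∈B = trans (C.C-level i (all-in-C k (B∖A-fractional k∈B k∉A)))
                                  (trans (solve 1 (λ v → v := v :* :1 :+ (:1 :- v) :* :0) refl v)
                                    (sym (cong₂ (λ r r′ → v * r + (1# - v) * r′) (ρ-∈ k∈B) (ρ-∉ k∉A))))
      ... | no  k∉A | no  k∉B = trans (≤-antisym (≮⇒≥ (k∉B ∘ B.∈-subset⁺)) (proj₁ (proj₁ x∈O k)))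
                                  (trans (solve 1 (λ v → :0 := v :* :0 :+ (:1 :- v) :* :0) refl v)
                                    (sym (cong₂ (λ r r′ → v * r + (1# - v) * r′) (ρ-∉ k∉B) (ρ-∉ k∉A))))

      0≤hA×0≤hB : (0# ≤ lin c (ρ A)) × (0# ≤ lin c (ρ B))
      0≤hA×0≤hB = nonNeg-factors 0≤hA*hB (proj₁ frac-i) (proj₂ frac-i)
        (subst (0# ≤_) (trans (lin-cong c x≡vB+[1-v]A) (lin-combination c v (1# - v) (ρ B) (ρ A))) 0≤hx)

      impossible : ⊥
      impossible = 0≢1 (trans (sym (ρ-∉ i∉A)) (trans (sym ρB≡ρA) (ρ-∈ i∈B)))
        where
          i∉A : i ∉ A
          i∉A i∈A = <⇒≢ (proj₂ frac-i) (A.∈-subset⁻ i∈A)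
          i∈B : i ∈ B
          i∈B = B.∈-subset⁺ (proj₁ frac-i)
          ρB≡ρA : ρ B i ≡ ρ A i
          ρB≡ρA = proj₂ x-vertex (ρ B) (ρ A) v (ideal⇒ρ∈O B-ideal , proj₂ 0≤hA×0≤hB) (ideal⇒ρ∈O A-ideal , proj₁ 0≤hA×0≤hB)
                    (proj₁ frac-i) (proj₂ frac-i) x≡vB+[1-v]A i

    no-fractional : ∀ i → ¬ Fractional x i
    no-fractional i frac-i with Fin.any? (λ k → fractional? x k ×-dec ¬? (k ∈? C.C i))
    ... | yes (j , frac-j , j∉Ci) = two-components frac-i frac-j j∉Ci
    ... | no  ∄j = OneComponent.impossible frac-i λ k frac-k → decidable-stable (k ∈? C.C i) λ k∉Ci → ∄j (k , frac-k , k∉Ci)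

  integral⇒vertex : ∀ {x} → O x → (∀ k → ¬ Fractional x k) → IsVertex O x
  integral⇒vertex {x} x∈O integral =
    x∈O , λ y z t y∈O z∈O 0<t t<1 x≡ k → coordinate y z t y∈O z∈O 0<t t<1 x≡ k (x k ≟ 0#) (x k ≟ 1#)
    where
      coordinate : ∀ y z t → O y → O z → 0# < t → t < 1# → (∀ k → x k ≡ t * y k + (1# - t) * z k) →
                   ∀ k → Dec (x k ≡ 0#) → Dec (x k ≡ 1#) → y k ≡ z k
      coordinate y z t y∈O z∈O 0<t t<1 x≡ k (yes xk≡0) _ =
        let (yk≡0 , zk≡0) = combination≡0⇒≡0 0<t t<1 (proj₁ (proj₁ y∈O k)) (proj₁ (proj₁ z∈O k)) (trans (sym (x≡ k)) xk≡0)
        in trans yk≡0 (sym zk≡0)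
      coordinate y z t y∈O z∈O 0<t t<1 x≡ k (no _) (yes xk≡1) =
        let (yk≡1 , zk≡1) = combination≡1⇒≡1 0<t t<1 (proj₂ (proj₁ y∈O k)) (proj₂ (proj₁ z∈O k)) (trans (sym (x≡ k)) xk≡1)
        in trans yk≡1 (sym zk≡1)
      coordinate y z t y∈O z∈O 0<t t<1 x≡ k (no xk≢0) (no xk≢1) =
        ⊥-elim (integral k (≤∧≢⇒< (proj₁ (proj₁ x∈O k)) (xk≢0 ∘ sym) , ≤∧≢⇒< (proj₂ (proj₁ x∈O k)) xk≢1))

  sign-condition⇒preserves : ∀ c → SignCondition c → PreservesUpperVertices c
  sign-condition⇒preserves c sign-condition x x-vertex =
    integral⇒vertex (proj₁ (proj₁ x-vertex)) (FractionalCoordinates.no-fractional c sign-condition x-vertex)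

  sign-condition-negate : ∀ c → SignCondition c → SignCondition (negate c)
  sign-condition-negate c sign-condition I J I-ideal J-ideal connected =
    subst (0# ≤_) (sym (trans (cong₂ _*_ (lin-negateˡ c (ρ I)) (lin-negateˡ c (ρ J)))
                              (solve 2 (λ a b → (:- a) :* (:- b) := a :* b) refl (lin c (ρ I)) (lin c (ρ J)))))
          (sign-condition I J I-ideal J-ideal connected)

module Separation (R : RealField) {d : ℕ} (_≼_ : Rel (Fin d) 0ℓ) (po : IsPartialOrder _≡_ _≼_) where
  open OrderedField R
  open PosetStuff _≼_
  open OrderPolytopeBasics R _≼_ po
  open SignConditionNecessity R _≼_ po
  open RelativeInteriorRoot R _≼_ po
  open SignConditionSufficiency R _≼_ po

  OppositeIdeals : Point d → Set
  OppositeIdeals c = Σ (Subset d) λ I → Σ (Subset d) λ J → IsIdeal I × IsIdeal J × (0# < lin c (ρ I)) × (lin c (ρ J) < 0#)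

  separating⇒conditions : ∀ c → ¬ (∀ i → c i ≡ 0#) → IsSeparatingHyperplane O c → OppositeIdeals c × SignCondition c
  separating⇒conditions c c≢0 ((x , hx≡0 , x-relint) , preserves⁺ , preserves⁻) =
    (I , J , I-ideal , J-ideal , 0<hI , hJ<0) ,
    preserves⇒sign-condition c preserves⁺
      (λ y y-vertex → preserves⁻ y (IsVertex-resp (UpperHalf-negate⇒LowerHalf c) (LowerHalf⇒UpperHalf-negate c) y-vertex))
    where
      I J : Subset d
      I = proj₁ (relint-root⇒positive-ideal c c≢0 x-relint hx≡0)
      J = proj₁ (relint-root⇒negative-ideal c c≢0 x-relint hx≡0)
      I-ideal : IsIdeal I
      I-ideal = proj₁ (proj₂ (relint-root⇒positive-ideal c c≢0 x-relint hx≡0))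
      J-ideal : IsIdeal J
      J-ideal = proj₁ (proj₂ (relint-root⇒negative-ideal c c≢0 x-relint hx≡0))
      0<hI : 0# < lin c (ρ I)
      0<hI = proj₂ (proj₂ (relint-root⇒positive-ideal c c≢0 x-relint hx≡0))
      hJ<0 : lin c (ρ J) < 0#
      hJ<0 = proj₂ (proj₂ (relint-root⇒negative-ideal c c≢0 x-relint hx≡0))

  conditions⇒separating : ∀ c → OppositeIdeals c × SignCondition c → IsSeparatingHyperplane O c
  conditions⇒separating c ((I , J , I-ideal , J-ideal , 0<hI , hJ<0) , sign-condition) =
      relint-root c (I , I-ideal , 0<hI) (J , J-ideal , hJ<0)
    , sign-condition⇒preserves c sign-condition
    , λ y y-vertex → sign-condition⇒preserves (negate c) (sign-condition-negate c sign-condition) y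
                       (IsVertex-resp (LowerHalf⇒UpperHalf-negate c) (UpperHalf-negate⇒LowerHalf c) y-vertex)

lemma2p7 : (R : RealField) → let open Geometry R in
    (d : ℕ) (_≼_ : Rel (Fin d) 0ℓ) → IsPartialOrder _≡_ _≼_ →
    (c : Point d) → ¬ (∀ i → c i ≡ 0#) →
    let open PosetStuff _≼_ in
    IsSeparatingHyperplane OrderPolytope c ⇔
      ((Σ (Subset d) λ I → Σ (Subset d) λ J → IsIdeal I × IsIdeal J ×
          (0# < lin c (ρ I)) × (lin c (ρ J) < 0#)) ×
       (∀ I J → IsIdeal I → IsIdeal J → Connected (symDiff I J) →
          0# ≤ lin c (ρ I) * lin c (ρ J)))
lemma2p7 R d _≼_ po c c≢0 = mk⇔ (separating⇒conditions c c≢0) (conditions⇒separating c)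
  where open Separation R _≼_ po
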